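{- Let $T$ be a decomposable tournament. (1) If $\Delta(T) = 2$, then $o_T(M) \leq 1$ for every $M \in {\rm mc}(T)$. (2) If $\Delta(T) = 3$, then $T$ admits a $\delta$-decomposition $D$ such that $o_T(M) \leq 1$ for every $M \in D$. (3) If $\Delta(T) \geq 4$, then $T$ admits a $\delta$-decomposition containing four elements $M_1,M_2,M_3,M_4$ such that: (a) $o_T(M_i) \leq 1$ for every $i \in \{1,3,4\}$; (b) $(u,v) \in A(T)$ for all $u \in M_1, v\in M_2$, and $(u,v)\in A(T)$ for all $u\in M_2, v\in M_3$; (c) there exists $x \in M_4$ such that $(x,v)\in A(T)$ for all $v \in M_1$, or $(u,x)\in A(T)$ for all $u\in M_3$.
   Context: A tournament $T$ is a finite vertex set $V(T)$ with an arc set $A(T)$ such that for all distinct $x,y$, exactly one of $(x,y),(y,x)$ lies in $A(T)$. A module of $T$ is a subset $M$ such that for all $x,y \in M$ and $v \notin M$, $(v,x)\in A(T)$ iff $(v,y)\in A(T)$; trivial modules are $\emptyset$, singletons and $V(T)$; $T$ is decomposable if it has a nontrivial module. With $\overline{X} = V(T)\setminus X$, a co-module is a set $M$ such that $M$ or $\overline{M}$ is a nontrivial module; a co-modular decomposition is a set of pairwise disjoint co-modules; $\Delta(T)$ is the largest size of a co-modular decomposition. A minimal co-module is one containing no other co-module; ${\rm mc}(T)$ is the set of these. A $\delta$-decomposition of $T$ is a co-modular decomposition $D$ with $|D|=\Delta(T)$ and $D\subseteq {\rm mc}(T)$. Two sets overlap if their intersection and both differences are nonempty. For $M \in {\rm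 mc}(T)$, $O_T(M)$ is the set of $N\in{\rm mc}(T)$ overlapping $M$, and $o_T(M)=|O_T(M)|$. -}

module Defs where

open import Data.Nat using (ℕ; _≤_)
open import Data.Bool using (Bool; true; false)
open import Data.Fin using (Fin)
open import Data.Fin.Subset using (Subset; ⊥; ⊤; ⁅_⁆; ∁; _∈_; _∉_; _⊆_; _∩_; _─_; Nonempty)
open import Data.List using (List; length)
open import Data.List.Relation.Unary.All using (All)
open import Data.List.Relation.Unary.AllPairs using (AllPairs)
open import Data.List.Relation.Unary.Unique.Propositional using (Unique)
import Data.List.Membership.Propositional as L
open import Data.Product using (Σ; ∃; _×_)
open import Data.Sum using (_⊎_)
open import Relation.Nullary using (¬_)
open import Relation.Binary.PropositionalEquality using (_≡_; _≢_)
open import Function.Bundles using (_⇔_)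

-- A tournament on the vertex set Fin n.  arc u v ≡ true means (u,v) ∈ A(T).
record Tournament (n : ℕ) : Set where
  field
    arc   : Fin n → Fin n → Bool
    irrefl : ∀ x → arc x x ≡ false
    total : ∀ x y → x ≢ y → arc x y ≡ true ⊎ arc y x ≡ true
    asym  : ∀ x y → arc x y ≡ true → arc y x ≡ false

open Tournament public

module _ {n : ℕ} (T : Tournament n) where

  Arc : Fin n → Fin n → Set
  Arc u v = arc T u v ≡ true

  IsModule : Subset n → Set
  IsModule M = ∀ x y v → x ∈ M → y ∈ M → v ∉ M → (Arc v x ⇔ Arc v y)

  NontrivialModule : Subset n → Set
  NontrivialModule M = IsModule M × ¬ Trivial M
    where
    Trivial : Subset n → Set
    Trivial M = M ≡ ⊥ ⊎ (∃ λ x → M ≡ ⁅ x ⁆) ⊎ M ≡ ⊤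

  Decomposable : Set
  Decomposable = ∃ λ M → NontrivialModule M

  CoModule : Subset n → Set
  CoModule M = NontrivialModule M ⊎ NontrivialModule (∁ M)

  Disjoint : Subset n → Subset n → Set
  Disjoint M N = ∀ x → x ∈ M → x ∉ N

  -- a co-modular decomposition: a finite set (duplicate-free list) of
  -- pairwise disjoint co-modules; its size is the length of the list
  CoModularDecomposition : List (Subset n) → Set
  CoModularDecomposition D = Unique D × All CoModule D × AllPairs Disjoint D

  DeltaIs : ℕ → Set
  DeltaIs k = (∃ λ D → CoModularDecomposition D × length D ≡ k)
            × (∀ D → CoModularDecomposition D → length D ≤ k)

  MinimalCoModule : Subset n → Set
  MinimalCoModule M = CoModule M × (∀ N → CoModule N → N ⊆ M → N ≡ M)

  IsDeltaDecomposition : ℕ → List (Subset n) → Set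
  IsDeltaDecomposition k D =
    CoModularDecomposition D × length D ≡ k × All MinimalCoModule D

  Overlap : Subset n → Subset n → Set
  Overlap M N = Nonempty (M ∩ N) × Nonempty (M ─ N) × Nonempty (N ─ M)

  O : Subset n → Subset n → Set
  O M N = MinimalCoModule N × Overlap M N

  HasCard : (Subset n → Set) → ℕ → Set
  HasCard S k = Σ (List (Subset n)) λ L →
    Unique L × (∀ N → (N L.∈ L ⇔ S N)) × length L ≡ k

  oLeq : Subset n → ℕ → Set
  oLeq M m = ∃ λ k → HasCard (O M) k × k ≤ m

-- Two overlapping minimal co-modules are nontrivial modules {a, b} and {b, c}. Chaining such pairs gives paths
-- p 0, …, p L along which all arcs point the same way, and the vertex set Q of a maximal path is a module, so ∁ Q
-- is a co-module. A minimal co-module overlapped by two others is an inner edge of such a path, while the end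
-- edges of a maximal path are overlapped at most once. For Δ = 2, the edges 0 and 2 with ∁ Q would already be
-- three disjoint co-modules. Otherwise start from a δ-decomposition: its members meeting Q are path edges, and
-- replacing the outermost ones by the end edges lowers the number of members overlapped twice, unless a third
-- member lies between them. Three members on a path together with ∁ Q contradict Δ = 3; for Δ ≥ 4 they become
-- M₁, M₂, M₃ after the replacement, and M₄ is a member outside Q or, if that one is overlapped twice, the first
-- edge of its own path. If no member is overlapped twice, any four members can be arranged: disjoint modules
-- dominate one another, and a vertex of a minimal co-module with modular complement is a source or a sink.
module Submission where

open import Defs
open import Data.Nat as ℕ using (ℕ; zero; suc; _≤_; _<_; _+_; _∸_; z≤n; s≤s)
import Data.Nat.Properties as ℕₚ
open import Data.Bool as Bool using (Bool; true; false; not)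
import Data.Bool.Properties as Boolₚ
open import Data.Fin as Fin using (Fin)
import Data.Fin.Properties as Finₚ
open import Data.Fin.Subset using (Subset; ⊤; _∈_; _∉_; _⊆_; _⊂_; ⁅_⁆; ∁; _∪_; _∩_; _─_; Nonempty; Empty; ∣_∣)
  renaming (⊥ to ∅)
open import Data.Fin.Subset.Properties
  using ( _∈?_; _⊆?_; nonempty?; anySubset?; ⊆-antisym; ∈⊤; ∉⊥; Empty-unique; x∈⁅x⁆; x∈⁅y⁆⇒x≡y; x∉⁅y⁆⇒x≢y
        ; x∈p⇒x∉∁p; x∈∁p⇒x∉p; x∉∁p⇒x∈p; x∉p⇒x∈∁p; x∈p∪q⁺; x∈p∪q⁻; x∈p∩q⁺; x∈p∩q⁻
        ; x∈p∧x∉q⇒x∈p─q; p─q⊆p; p∩q⊆p; p⊂q⇒∣p∣<∣q∣ )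
open import Data.Vec using (_∷_; here; there)
import Data.Vec.Properties as Vecₚ
open import Data.List using (List; []; _∷_; length; map; _++_; lookup)
import Data.List.Properties as Listₚ
open import Data.List.Relation.Unary.All as All using (All; []; _∷_)
import Data.List.Relation.Unary.All.Properties as Allₚ
open import Data.List.Relation.Unary.Any as Any using (Any; here; there)
open import Data.List.Relation.Unary.AllPairs using (AllPairs; []; _∷_)
import Data.List.Relation.Unary.AllPairs.Properties as AllPairsₚ
open import Data.List.Relation.Unary.Unique.Propositional using (Unique)
open import Data.List.Membership.Propositional using (find) renaming (_∈_ to _∈ₗ_)
import Data.List.Membership.Propositional.Properties as Membershipₚ
open import Data.Product using (Σ; ∃; _×_; _,_; proj₁; proj₂; swap)
open import Data.Sum as Sum using (_⊎_; inj₁; inj₂)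
open import Data.Empty using (⊥; ⊥-elim)
open import Relation.Nullary using (¬_; Dec; yes; no)
open import Relation.Nullary.Decidable using (_×-dec_; _⊎-dec_; _→-dec_; ¬?; map′)
open import Relation.Binary.Definitions using (DecidableEquality; tri<; tri≈; tri>)
open import Relation.Binary.PropositionalEquality using (_≡_; _≢_; refl; sym; trans; cong; subst; module ≡-Reasoning)
open import Function.Bundles using (mk⇔)

≢-sym : {A : Set} {x y : A} → x ≢ y → y ≢ x
≢-sym x≢y y≡x = x≢y (sym y≡x)

<-distinct⇒injective : {A : Set} {L : ℕ} {f : ℕ → A} → (∀ {i j} → i < j → j ≤ L → f i ≢ f j) →
                       ∀ {i j} → i ≤ L → j ≤ L → f i ≡ f j → i ≡ j
<-distinct⇒injective distinct {i} {j} i≤L j≤L e with ℕₚ.<-cmp i j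
... | tri< i<j _ _ = ⊥-elim (distinct i<j j≤L e)
... | tri≈ _ i≡j _ = i≡j
... | tri> _ _ j<i = ⊥-elim (distinct j<i i≤L (sym e))

x∈p─q⇒x∉q : {n : ℕ} (p q : Subset n) {x : Fin n} → x ∈ p ─ q → x ∉ q
x∈p─q⇒x∉q (_ ∷ p) (true ∷ q) {Fin.zero} () _
x∈p─q⇒x∉q (_ ∷ p) (false ∷ q) {Fin.zero} _ ()
x∈p─q⇒x∉q (_ ∷ p) (_ ∷ q) {Fin.suc x} (there h) (there h′) = x∈p─q⇒x∉q p q h h′

least : {P : ℕ → Set} → (∀ j → Dec (P j)) → ∀ {s} → P s → ∃ λ i → P i × (∀ j → P j → i ≤ j)
least {P} P? {s} Ps = search s 0 Ps (λ _ ())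
  where
  search : ∀ d c → P (c + d) → (∀ j → j < c → ¬ P j) → ∃ λ i → P i × (∀ j → P j → i ≤ j)
  search d c Pc+d below with P? c
  ... | yes Pc = c , Pc , λ j Pj → ℕₚ.≮⇒≥ (λ j<c → below j j<c Pj)
  ... | no ¬Pc with d
  ...   | zero = ⊥-elim (¬Pc (subst P (ℕₚ.+-identityʳ c) Pc+d))
  ...   | suc d′ = search d′ (suc c) (subst P (ℕₚ.+-suc c d′) Pc+d) below′
    where
    below′ : ∀ j → j < suc c → ¬ P j
    below′ j j< with ℕₚ.m≤n⇒m<n∨m≡n (ℕₚ.≤-pred j<)
    ... | inj₁ j<c = below j j<c
    ... | inj₂ refl = ¬Pc

greatest : {P : ℕ → Set} → (∀ j → Dec (P j)) → ∀ c → (∀ j → P j → j ≤ c) → ∀ {s} → P s →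
           ∃ λ l → P l × (∀ j → P j → j ≤ l)
greatest {P} P? c bound {s} Ps with P? c
... | yes Pc = c , Pc , bound
... | no ¬Pc with c
...   | zero = ⊥-elim (¬Pc (subst P (ℕₚ.n≤0⇒n≡0 (bound s Ps)) Ps))
...   | suc c′ = greatest P? c′ bound′ Ps
  where
  bound′ : ∀ j → P j → j ≤ c′
  bound′ j Pj with ℕₚ.m≤n⇒m<n∨m≡n (bound j Pj)
  ... | inj₁ j< = ℕₚ.≤-pred j<
  ... | inj₂ refl = ⊥-elim (¬Pc Pj)

skipsSuccessor⇒2≤ : ∀ {i s} → i ≤ s → s ≢ i → suc i ≢ s → 2 ≤ s
skipsSuccessor⇒2≤ i≤s s≢i suc[i]≢s = ℕₚ.≤-trans (s≤s (s≤s z≤n)) (ℕₚ.≤∧≢⇒< (ℕₚ.≤∧≢⇒< i≤s (≢-sym s≢i)) suc[i]≢s)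

skipsPredecessor⇒≤ : ∀ {s l k} → s ≤ l → s ≢ l → suc s ≢ l → l ≤ 2 + k → s ≤ k
skipsPredecessor⇒≤ s≤l s≢l suc[s]≢l l≤ = ℕₚ.≤-pred (ℕₚ.≤-pred (ℕₚ.≤-trans (ℕₚ.≤∧≢⇒< (ℕₚ.≤∧≢⇒< s≤l s≢l) suc[s]≢l) l≤))

suc-if : {P : Set} → Dec P → ℕ → ℕ
suc-if (yes _) r = suc r
suc-if (no _) r = r

suc-if-mono-≤ : {P R : Set} (P? : Dec P) (R? : Dec R) {r s : ℕ} → (R → P) → r ≤ s → suc-if R? r ≤ suc-if P? s
suc-if-mono-≤ (yes _) (yes _) _ r≤s = s≤s r≤s
suc-if-mono-≤ (no ¬p) (yes x) R→P _ = ⊥-elim (¬p (R→P x))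
suc-if-mono-≤ (yes _) (no _) _ r≤s = ℕₚ.m≤n⇒m≤1+n r≤s
suc-if-mono-≤ (no _) (no _) _ r≤s = r≤s

suc-if-mono-< : {P R : Set} (P? : Dec P) (R? : Dec R) {r s : ℕ} → (R → P) → r < s → suc-if R? r < suc-if P? s
suc-if-mono-< (yes _) (yes _) _ r<s = s≤s r<s
suc-if-mono-< (no ¬p) (yes x) R→P _ = ⊥-elim (¬p (R→P x))
suc-if-mono-< (yes _) (no _) _ r<s = ℕₚ.m≤n⇒m≤1+n r<s
suc-if-mono-< (no _) (no _) _ r<s = r<s

suc-if-drop : {P R : Set} (P? : Dec P) (R? : Dec R) {r s : ℕ} → P → ¬ R → r ≤ s → suc-if R? r < suc-if P? s
suc-if-drop (yes _) (no _) _ _ r≤s = s≤s r≤s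
suc-if-drop (no ¬p) _ p _ _ = ⊥-elim (¬p p)
suc-if-drop _ (yes x) _ ¬r _ = ⊥-elim (¬r x)

module _ {A : Set} where

  AllPairs-map-∈ : {R S : A → A → Set} {xs : List A} → (∀ {x y} → x ∈ₗ xs → y ∈ₗ xs → R x y → S x y) →
                   AllPairs R xs → AllPairs S xs
  AllPairs-map-∈ f [] = []
  AllPairs-map-∈ f (rs ∷ rss) =
    All.tabulate (λ m → f (here refl) (there m) (All.lookup rs m)) ∷ AllPairs-map-∈ (λ a b → f (there a) (there b)) rss

  AllPairs-lookup : {R : A → A → Set} {xs : List A} → AllPairs R xs → {a b : Fin (length xs)} → a ≢ b →
                    R (lookup xs a) (lookup xs b) ⊎ R (lookup xs b) (lookup xs a)
  AllPairs-lookup (rs ∷ rss) {Fin.zero} {Fin.zero} a≢b = ⊥-elim (a≢b refl)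
  AllPairs-lookup (rs ∷ rss) {Fin.zero} {Fin.suc b} _ = inj₁ (All.lookup rs (Membershipₚ.∈-lookup b))
  AllPairs-lookup (rs ∷ rss) {Fin.suc a} {Fin.zero} _ = inj₂ (All.lookup rs (Membershipₚ.∈-lookup a))
  AllPairs-lookup (rs ∷ rss) {Fin.suc a} {Fin.suc b} a≢b = AllPairs-lookup rss (λ e → a≢b (cong Fin.suc e))

module _ {n : ℕ} where

  _≟ₛ_ : DecidableEquality (Subset n)
  _≟ₛ_ = Vecₚ.≡-dec Bool._≟_

  ∁-involutive : (p : Subset n) → ∁ (∁ p) ≡ p
  ∁-involutive p = ⊆-antisym (λ h → x∉∁p⇒x∈p (x∈∁p⇒x∉p h)) (λ h → x∉p⇒x∈∁p (x∈p⇒x∉∁p h))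

  Empty─⇒⊆ : {p q : Subset n} → Empty (p ─ q) → p ⊆ q
  Empty─⇒⊆ {q = q} empty {x} x∈p with x ∈? q
  ... | yes x∈q = x∈q
  ... | no x∉q = ⊥-elim (empty (x , x∈p∧x∉q⇒x∈p─q x∈p x∉q))

  ⊈⇒Nonempty─ : {p q : Subset n} → ¬ (p ⊆ q) → Nonempty (p ─ q)
  ⊈⇒Nonempty─ {p} {q} p⊈q with nonempty? (p ─ q)
  ... | yes ne = ne
  ... | no empty = ⊥-elim (p⊈q (Empty─⇒⊆ empty))

  ⊆∧≢⇒⊂ : {p q : Subset n} → p ⊆ q → p ≢ q → p ⊂ q
  ⊆∧≢⇒⊂ p⊆q p≢q =
    let (x , x∈q─p) = ⊈⇒Nonempty─ (λ q⊆p → p≢q (⊆-antisym p⊆q q⊆p))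
    in p⊆q , x , p─q⊆p _ _ x∈q─p , x∈p─q⇒x∉q _ _ x∈q─p

  Empty∁⇒≡⊤ : {p : Subset n} → Empty (∁ p) → p ≡ ⊤
  Empty∁⇒≡⊤ {p} empty = ⊆-antisym (λ _ → ∈⊤) (λ {x} _ → x∉∁p⇒x∈p (λ x∈∁p → empty (x , x∈∁p)))

  pair : Fin n → Fin n → Subset n
  pair x y = ⁅ x ⁆ ∪ ⁅ y ⁆

  ∈-pair⁻ : {x y z : Fin n} → z ∈ pair x y → z ≡ x ⊎ z ≡ y
  ∈-pair⁻ {x} {y} h = Sum.map (x∈⁅y⁆⇒x≡y x) (x∈⁅y⁆⇒x≡y y) (x∈p∪q⁻ ⁅ x ⁆ ⁅ y ⁆ h)

  ∈-pair⁺ : {x y z : Fin n} → z ≡ x ⊎ z ≡ y → z ∈ pair x y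
  ∈-pair⁺ (inj₁ refl) = x∈p∪q⁺ (inj₁ (x∈⁅x⁆ _))
  ∈-pair⁺ (inj₂ refl) = x∈p∪q⁺ (inj₂ (x∈⁅x⁆ _))

  x∈pair : {x y : Fin n} → x ∈ pair x y
  x∈pair = ∈-pair⁺ (inj₁ refl)

  y∈pair : {x y : Fin n} → y ∈ pair x y
  y∈pair = ∈-pair⁺ (inj₂ refl)

  ∉-pair : {x y z : Fin n} → z ≢ x → z ≢ y → z ∉ pair x y
  ∉-pair z≢x z≢y h = Sum.[ z≢x , z≢y ] (∈-pair⁻ h)

  pair-comm : {x y : Fin n} → pair x y ≡ pair y x
  pair-comm = ⊆-antisym (λ h → ∈-pair⁺ (Sum.swap (∈-pair⁻ h))) (λ h → ∈-pair⁺ (Sum.swap (∈-pair⁻ h)))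

module _ {n : ℕ} (T : Tournament n) where

  arc-flip : {x y : Fin n} → x ≢ y → arc T y x ≡ not (arc T x y)
  arc-flip {x} {y} x≢y with total T x y x≢y
  ... | inj₁ xy rewrite xy = asym T x y xy
  ... | inj₂ yx rewrite yx | asym T y x yx = refl

  isModule⇒arc≡ : {M : Subset n} {x y v : Fin n} → IsModule T M → x ∈ M → y ∈ M → v ∉ M →
                  arc T v x ≡ arc T v y
  isModule⇒arc≡ m x∈M y∈M v∉M = Boolₚ.⇔→≡ (m _ _ _ x∈M y∈M v∉M)

  isModule⁺ : {M : Subset n} → (∀ x y v → x ∈ M → y ∈ M → v ∉ M → arc T v x ≡ arc T v y) → IsModule T M
  isModule⁺ f x y v x∈M y∈M v∉M =
    mk⇔ (λ e → trans (sym (f x y v x∈M y∈M v∉M)) e) (λ e → trans (f x y v x∈M y∈M v∉M) e)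

  nontrivial⁺ : {M : Subset n} {x y z : Fin n} → IsModule T M → x ∈ M → y ∈ M → x ≢ y → z ∉ M →
                NontrivialModule T M
  nontrivial⁺ {M} {x} {y} {z} m x∈M y∈M x≢y z∉M = m , trivial
    where
    trivial : ¬ (M ≡ ∅ ⊎ (∃ λ w → M ≡ ⁅ w ⁆) ⊎ M ≡ ⊤)
    trivial (inj₁ M≡⊥) = ∉⊥ (subst (x ∈_) M≡⊥ x∈M)
    trivial (inj₂ (inj₁ (w , M≡w))) =
      x≢y (trans (x∈⁅y⁆⇒x≡y w (subst (x ∈_) M≡w x∈M)) (sym (x∈⁅y⁆⇒x≡y w (subst (y ∈_) M≡w y∈M))))
    trivial (inj₂ (inj₂ M≡⊤)) = z∉M (subst (z ∈_) (sym M≡⊤) ∈⊤)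

  record NontrivialWitness (M : Subset n) : Set where
    constructor witness
    field
      x₁ x₂ outside : Fin n
      x₁∈ : x₁ ∈ M
      x₂∈ : x₂ ∈ M
      x₁≢x₂ : x₁ ≢ x₂
      outside∉ : outside ∉ M

  nontrivial⁻ : {M : Subset n} → NontrivialModule T M → NontrivialWitness M
  nontrivial⁻ {M} (_ , nontrivial) with nonempty? M
  ... | no empty = ⊥-elim (nontrivial (inj₁ (Empty-unique empty)))
  ... | yes (x , x∈M) with nonempty? (M ─ ⁅ x ⁆)
  ...   | no single = ⊥-elim (nontrivial (inj₂ (inj₁ (x , ⊆-antisym (Empty─⇒⊆ single) ⁅x⁆⊆M))))
    where
    ⁅x⁆⊆M : ⁅ x ⁆ ⊆ M
    ⁅x⁆⊆M y∈⁅x⁆ = subst (_∈ M) (sym (x∈⁅y⁆⇒x≡y x y∈⁅x⁆)) x∈M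
  ...   | yes (y , y∈M─x) with nonempty? (∁ M)
  ...     | no full = ⊥-elim (nontrivial (inj₂ (inj₂ (Empty∁⇒≡⊤ full))))
  ...     | yes (z , z∈∁M) =
    witness y x z (p─q⊆p M _ y∈M─x) x∈M (x∉⁅y⁆⇒x≢y (x∈p─q⇒x∉q M _ y∈M─x)) (x∈∁p⇒x∉p z∈∁M)

  coModule-nonempty : {M : Subset n} → CoModule T M → Nonempty M
  coModule-nonempty (inj₁ nt) = let open NontrivialWitness (nontrivial⁻ nt) in x₁ , x₁∈
  coModule-nonempty (inj₂ nt) = let open NontrivialWitness (nontrivial⁻ nt) in outside , x∉∁p⇒x∈p outside∉

  isModule? : (M : Subset n) → Dec (IsModule T M)
  isModule? M = map′ isModule⁺ (λ m x y v → isModule⇒arc≡ m)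
    (Finₚ.all? λ x → Finₚ.all? λ y → Finₚ.all? λ v →
      (x ∈? M) →-dec ((y ∈? M) →-dec (¬? (v ∈? M) →-dec (arc T v x Bool.≟ arc T v y))))

  nontrivialModule? : (M : Subset n) → Dec (NontrivialModule T M)
  nontrivialModule? M =
    isModule? M ×-dec ¬? ((M ≟ₛ ∅) ⊎-dec (Finₚ.any? (λ x → M ≟ₛ ⁅ x ⁆) ⊎-dec (M ≟ₛ ⊤)))

  coModule? : (M : Subset n) → Dec (CoModule T M)
  coModule? M = nontrivialModule? M ⊎-dec nontrivialModule? (∁ M)

  ProperCoModule : Subset n → Set
  ProperCoModule M = ∃ λ N → CoModule T N × N ⊆ M × N ≢ M

  properCoModule? : (M : Subset n) → Dec (ProperCoModule M)
  properCoModule? M = anySubset? (λ N → coModule? N ×-dec (N ⊆? M) ×-dec ¬? (N ≟ₛ M))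

  minimalCoModule⁺ : {M : Subset n} → CoModule T M → ¬ ProperCoModule M → MinimalCoModule T M
  minimalCoModule⁺ {M} cM none = cM , minimal
    where
    minimal : ∀ N → CoModule T N → N ⊆ M → N ≡ M
    minimal N cN N⊆M with N ≟ₛ M
    ... | yes N≡M = N≡M
    ... | no N≢M = ⊥-elim (none (N , cN , N⊆M , N≢M))

  minimalCoModule? : (M : Subset n) → Dec (MinimalCoModule T M)
  minimalCoModule? M = map′ (λ (cM , none) → minimalCoModule⁺ cM none) (λ (cM , min) → cM , smaller min)
                            (coModule? M ×-dec ¬? (properCoModule? M))
    where
    smaller : (∀ N → CoModule T N → N ⊆ M → N ≡ M) → ¬ ProperCoModule M
    smaller min (N , cN , N⊆M , N≢M) = N≢M (min N cN N⊆M)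

  O? : (M N : Subset n) → Dec (O T M N)
  O? M N = minimalCoModule? N ×-dec nonempty? (M ∩ N) ×-dec nonempty? (M ─ N) ×-dec nonempty? (N ─ M)

  TwoOverlaps : Subset n → Set
  TwoOverlaps M = ∃ λ N₁ → ∃ λ N₂ → O T M N₁ × O T M N₂ × N₁ ≢ N₂

  twoOverlaps? : (M : Subset n) → Dec (TwoOverlaps M)
  twoOverlaps? M = anySubset? λ N₁ → anySubset? λ N₂ → O? M N₁ ×-dec O? M N₂ ×-dec ¬? (N₁ ≟ₛ N₂)

  ¬TwoOverlaps⇒o≤1 : {M : Subset n} → ¬ TwoOverlaps M → oLeq T M 1
  ¬TwoOverlaps⇒o≤1 {M} ¬two with anySubset? (O? M)
  ... | no none = 0 , ([] , [] , (λ N → mk⇔ (λ ()) (λ o → ⊥-elim (none (N , o)))) , refl) , z≤n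
  ... | yes (N₀ , o₀) = 1 , ((N₀ ∷ []) , ([] ∷ []) , (λ N → mk⇔ (only N) (listed N)) , refl) , s≤s z≤n
    where
    only : ∀ N → N ∈ₗ (N₀ ∷ []) → O T M N
    only N (here refl) = o₀
    listed : ∀ N → O T M N → N ∈ₗ (N₀ ∷ [])
    listed N o with N ≟ₛ N₀
    ... | yes N≡N₀ = here N≡N₀
    ... | no N≢N₀ = ⊥-elim (¬two (N , N₀ , o , o₀ , N≢N₀))

  ∪-isModule : {M N : Subset n} {x : Fin n} → IsModule T M → IsModule T N → x ∈ M → x ∈ N → IsModule T (M ∪ N)
  ∪-isModule {M} {N} {x} mM mN x∈M x∈N = isModule⁺ λ u w v u∈ w∈ v∉ → trans (toX u v u∈ v∉) (sym (toX w v w∈ v∉))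
    where
    toX : ∀ u v → u ∈ M ∪ N → v ∉ M ∪ N → arc T v u ≡ arc T v x
    toX u v u∈ v∉ with x∈p∪q⁻ M N u∈
    ... | inj₁ u∈M = isModule⇒arc≡ mM u∈M x∈M (λ v∈M → v∉ (x∈p∪q⁺ (inj₁ v∈M)))
    ... | inj₂ u∈N = isModule⇒arc≡ mN u∈N x∈N (λ v∈N → v∉ (x∈p∪q⁺ (inj₂ v∈N)))

  ∩-isModule : {M N : Subset n} → IsModule T M → IsModule T N → IsModule T (M ∩ N)
  ∩-isModule {M} {N} mM mN = isModule⁺ same
    where
    same : ∀ u w v → u ∈ M ∩ N → w ∈ M ∩ N → v ∉ M ∩ N → arc T v u ≡ arc T v w
    same u w v u∈ w∈ v∉ with v ∈? M
    ... | no v∉M = isModule⇒arc≡ mM (proj₁ (x∈p∩q⁻ M N u∈)) (proj₁ (x∈p∩q⁻ M N w∈)) v∉M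
    ... | yes v∈M = isModule⇒arc≡ mN (proj₂ (x∈p∩q⁻ M N u∈)) (proj₂ (x∈p∩q⁻ M N w∈)) (λ v∈N → v∉ (x∈p∩q⁺ (v∈M , v∈N)))

  ─-isModule : {M N : Subset n} {y : Fin n} → IsModule T M → IsModule T N → y ∈ N → y ∉ M → IsModule T (M ─ N)
  ─-isModule {M} {N} {y} mM mN y∈N y∉M = isModule⁺ same
    where
    ∈∉⇒≢ : ∀ {P : Subset n} {p q} → p ∈ P → q ∉ P → p ≢ q
    ∈∉⇒≢ p∈P q∉P refl = q∉P p∈P
    fromInside : ∀ u v → u ∈ M ─ N → v ∈ M → v ∈ N → arc T v u ≡ arc T y v
    fromInside u v u∈ v∈M v∈N =
      let u∈M = p─q⊆p M N u∈ ; u∉N = x∈p─q⇒x∉q M N u∈ in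
      trans (arc-flip (≢-sym (∈∉⇒≢ v∈N u∉N)))
        (trans (cong not (isModule⇒arc≡ mN v∈N y∈N u∉N))
          (trans (sym (arc-flip (≢-sym (∈∉⇒≢ y∈N u∉N)))) (isModule⇒arc≡ mM u∈M v∈M y∉M)))
    same : ∀ u w v → u ∈ M ─ N → w ∈ M ─ N → v ∉ M ─ N → arc T v u ≡ arc T v w
    same u w v u∈ w∈ v∉ with v ∈? M
    ... | no v∉M = isModule⇒arc≡ mM (p─q⊆p M N u∈) (p─q⊆p M N w∈) v∉M
    ... | yes v∈M with v ∈? N
    ...   | no v∉N = ⊥-elim (v∉ (x∈p∧x∉q⇒x∈p─q v∈M v∉N))
    ...   | yes v∈N = trans (fromInside u v u∈ v∈M v∈N) (sym (fromInside w v w∈ v∈M v∈N))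

  nontrivial-⊆ : {A B : Subset n} {z : Fin n} → NontrivialModule T A → IsModule T B → A ⊆ B → z ∉ B →
                 NontrivialModule T B
  nontrivial-⊆ ntA mB A⊆B z∉B = let open NontrivialWitness (nontrivial⁻ ntA) in nontrivial⁺ mB (A⊆B x₁∈) (A⊆B x₂∈) x₁≢x₂ z∉B

  Overlap-sym : {M N : Subset n} → Overlap T M N → Overlap T N M
  Overlap-sym {M} {N} ((u , u∈M∩N) , M─N , N─M) =
    (u , x∈p∩q⁺ (swap (x∈p∩q⁻ M N u∈M∩N))) , N─M , M─N

  -- ∁ M ∪ X is a nontrivial module, so its complement M ─ X is a co-module strictly inside M.
  complementModule-noCrossing : {M X : Subset n} {y w u : Fin n} → MinimalCoModule T M → NontrivialModule T (∁ M) →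
    IsModule T X → y ∈ X → y ∉ M → w ∈ M → w ∉ X → u ∈ M → u ∈ X → ⊥
  complementModule-noCrossing {M} {X} {y} {w} {u} (_ , minimal) nt∁M mX y∈X y∉M w∈M w∉X u∈M u∈X =
    x∈∁p⇒x∉p (subst (u ∈_) (sym M─X≡M) u∈M) (x∈p∪q⁺ (inj₂ u∈X))
    where
    B : Subset n
    B = ∁ M ∪ X
    ntB : NontrivialModule T B
    ntB = nontrivial-⊆ nt∁M (∪-isModule (proj₁ nt∁M) mX (x∉p⇒x∈∁p y∉M) y∈X) (λ h → x∈p∪q⁺ (inj₁ h))
            (λ h → Sum.[ x∈p⇒x∉∁p w∈M , w∉X ] (x∈p∪q⁻ (∁ M) X h))
    M─X≡M : ∁ B ≡ M
    M─X≡M = minimal (∁ B) (inj₂ (subst (NontrivialModule T) (sym (∁-involutive B)) ntB))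
                    (λ h → x∉∁p⇒x∈p (λ h′ → x∈∁p⇒x∉p h (x∈p∪q⁺ (inj₁ h′))))

  complementModule-noOverlap : {M N : Subset n} → MinimalCoModule T M → NontrivialModule T (∁ M) → CoModule T N →
    ¬ Overlap T M N
  complementModule-noOverlap {M} {N} mcM nt∁M (inj₁ ntN) ((u , u∈M∩N) , (w , w∈M─N) , (y , y∈N─M)) =
    complementModule-noCrossing mcM nt∁M (proj₁ ntN) (p─q⊆p N M y∈N─M) (x∈p─q⇒x∉q N M y∈N─M)
      (p─q⊆p M N w∈M─N) (x∈p─q⇒x∉q M N w∈M─N) (proj₁ (x∈p∩q⁻ M N u∈M∩N)) (proj₂ (x∈p∩q⁻ M N u∈M∩N))
  complementModule-noOverlap {M} {N} mcM nt∁M (inj₂ nt∁N) ((u , u∈M∩N) , (w , w∈M─N) , _) with nonempty? (∁ (M ∪ N))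
  ... | yes (z , z∉M∪N) =
    complementModule-noCrossing mcM nt∁M (proj₁ nt∁N) (x∉p⇒x∈∁p (λ h → x∈∁p⇒x∉p z∉M∪N (x∈p∪q⁺ (inj₂ h))))
      (λ h → x∈∁p⇒x∉p z∉M∪N (x∈p∪q⁺ (inj₁ h)))
      (proj₁ (x∈p∩q⁻ M N u∈M∩N)) (x∈p⇒x∉∁p (proj₂ (x∈p∩q⁻ M N u∈M∩N)))
      (p─q⊆p M N w∈M─N) (x∉p⇒x∈∁p (x∈p─q⇒x∉q M N w∈M─N))
  ... | no M∪N-full = x∈∁p⇒x∉p (subst (u ∈_) (sym ∁N≡M) (proj₁ (x∈p∩q⁻ M N u∈M∩N))) (proj₂ (x∈p∩q⁻ M N u∈M∩N))
    where
    ∁N⊆M : ∁ N ⊆ M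
    ∁N⊆M {x} x∈∁N with x ∈? M
    ... | yes x∈M = x∈M
    ... | no x∉M = ⊥-elim (M∪N-full (x , x∉p⇒x∈∁p (λ h → Sum.[ x∉M , x∈∁p⇒x∉p x∈∁N ] (x∈p∪q⁻ M N h))))
    ∁N≡M : ∁ N ≡ M
    ∁N≡M = proj₂ mcM (∁ N) (inj₁ nt∁N) ∁N⊆M

  overlap⇒nontrivialModule : {M N : Subset n} → MinimalCoModule T M → CoModule T N → Overlap T M N →
                             NontrivialModule T M
  overlap⇒nontrivialModule mcM cN ov with proj₁ mcM
  ... | inj₁ ntM = ntM
  ... | inj₂ nt∁M = ⊥-elim (complementModule-noOverlap mcM nt∁M cN ov)

  submodule-subsingleton : {M X : Subset n} {e : Fin n} → MinimalCoModule T M → NontrivialModule T M →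
    IsModule T X → X ⊆ M → e ∈ M → e ∉ X → {p q : Fin n} → p ∈ X → q ∈ X → p ≡ q
  submodule-subsingleton {M} {X} mcM ntM mX X⊆M e∈M e∉X {p} {q} p∈X q∈X with p Fin.≟ q
  ... | yes p≡q = p≡q
  ... | no p≢q = ⊥-elim (e∉X (subst (_ ∈_) (sym X≡M) e∈M))
    where
    open NontrivialWitness (nontrivial⁻ ntM)
    X≡M : X ≡ M
    X≡M = proj₂ mcM X (inj₁ (nontrivial⁺ mX p∈X q∈X p≢q (λ h → outside∉ (X⊆M h)))) X⊆M

  record PairOverlap (M N : Subset n) : Set where
    constructor pairOverlap
    field
      a b c : Fin n
      a≢b : a ≢ b
      b≢c : b ≢ c
      a≢c : a ≢ c
      M≡ab : M ≡ pair a b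
      N≡bc : N ≡ pair b c
      ntM : NontrivialModule T M
      ntN : NontrivialModule T N

  -- M ∩ N, M ─ N and N ─ M are modules, hence singletons by minimality.
  overlap⇒pairs : {M N : Subset n} → MinimalCoModule T M → MinimalCoModule T N → Overlap T M N → PairOverlap M N
  overlap⇒pairs {M} {N} mcM mcN ov@((b , b∈M∩N) , (x , x∈M─N) , (c , c∈N─M)) =
    pairOverlap x b c x≢b b≢c x≢c M≡xb N≡bc ntM ntN
    where
    ntM : NontrivialModule T M
    ntM = overlap⇒nontrivialModule mcM (proj₁ mcN) ov
    ntN : NontrivialModule T N
    ntN = overlap⇒nontrivialModule mcN (proj₁ mcM) (Overlap-sym ov)
    b∈M : b ∈ M
    b∈M = proj₁ (x∈p∩q⁻ M N b∈M∩N)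
    b∈N : b ∈ N
    b∈N = proj₂ (x∈p∩q⁻ M N b∈M∩N)
    x∈M : x ∈ M
    x∈M = p─q⊆p M N x∈M─N
    x∉N : x ∉ N
    x∉N = x∈p─q⇒x∉q M N x∈M─N
    c∈N : c ∈ N
    c∈N = p─q⊆p N M c∈N─M
    c∉M : c ∉ M
    c∉M = x∈p─q⇒x∉q N M c∈N─M
    x≢b : x ≢ b
    x≢b refl = x∉N b∈N
    b≢c : b ≢ c
    b≢c refl = c∉M b∈M
    x≢c : x ≢ c
    x≢c refl = c∉M x∈M
    M∩N-single : ∀ {p q} → p ∈ M ∩ N → q ∈ M ∩ N → p ≡ q
    M∩N-single = submodule-subsingleton mcM ntM (∩-isModule (proj₁ ntM) (proj₁ ntN)) (p∩q⊆p M N) x∈M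
                   (λ h → x∉N (proj₂ (x∈p∩q⁻ M N h)))
    M─N-single : ∀ {p q} → p ∈ M ─ N → q ∈ M ─ N → p ≡ q
    M─N-single = submodule-subsingleton mcM ntM (─-isModule (proj₁ ntM) (proj₁ ntN) c∈N c∉M) (p─q⊆p M N) b∈M
                   (λ h → x∈p─q⇒x∉q M N h b∈N)
    N─M-single : ∀ {p q} → p ∈ N ─ M → q ∈ N ─ M → p ≡ q
    N─M-single = submodule-subsingleton mcN ntN (─-isModule (proj₁ ntN) (proj₁ ntM) x∈M x∉N) (p─q⊆p N M) b∈N
                   (λ h → x∈p─q⇒x∉q N M h b∈M)
    M≡xb : M ≡ pair x b
    M≡xb = ⊆-antisym M⊆ (λ h → Sum.[ (λ e → subst (_∈ M) (sym e) x∈M) , (λ e → subst (_∈ M) (sym e) b∈M) ] (∈-pair⁻ h))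
      where
      M⊆ : M ⊆ pair x b
      M⊆ {z} z∈M with z ∈? N
      ... | yes z∈N = ∈-pair⁺ (inj₂ (M∩N-single (x∈p∩q⁺ (z∈M , z∈N)) b∈M∩N))
      ... | no z∉N = ∈-pair⁺ (inj₁ (M─N-single (x∈p∧x∉q⇒x∈p─q z∈M z∉N) x∈M─N))
    N≡bc : N ≡ pair b c
    N≡bc = ⊆-antisym N⊆ (λ h → Sum.[ (λ e → subst (_∈ N) (sym e) b∈N) , (λ e → subst (_∈ N) (sym e) c∈N) ] (∈-pair⁻ h))
      where
      N⊆ : N ⊆ pair b c
      N⊆ {z} z∈N with z ∈? M
      ... | yes z∈M = ∈-pair⁺ (inj₁ (M∩N-single (x∈p∩q⁺ (z∈M , z∈N)) b∈M∩N))
      ... | no z∉M = ∈-pair⁺ (inj₂ (N─M-single (x∈p∧x∉q⇒x∈p─q z∈N z∉M) c∈N─M))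

  pairModules-orient : {x y z : Fin n} → IsModule T (pair x y) → IsModule T (pair y z) → x ≢ y → y ≢ z → x ≢ z →
                       arc T x y ≡ arc T y z × arc T x z ≡ arc T x y
  pairModules-orient {x} {y} {z} mxy myz x≢y y≢z x≢z = chain , sym x→y≡x→z
    where
    z→x≡z→y : arc T z x ≡ arc T z y
    z→x≡z→y = isModule⇒arc≡ mxy x∈pair y∈pair (∉-pair (≢-sym x≢z) (≢-sym y≢z))
    x→y≡x→z : arc T x y ≡ arc T x z
    x→y≡x→z = isModule⇒arc≡ myz x∈pair y∈pair (∉-pair x≢y x≢z)
    open ≡-Reasoning
    chain : arc T x y ≡ arc T y z
    chain = begin
      arc T x y        ≡⟨ x→y≡x→z ⟩
      arc T x z        ≡⟨ arc-flip (≢-sym x≢z) ⟩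
      not (arc T z x)  ≡⟨ cong not z→x≡z→y ⟩
      not (arc T z y)  ≡⟨ arc-flip (≢-sym y≢z) ⟨
      arc T y z        ∎

  pairModules-noStar : {p q r s : Fin n} → IsModule T (pair p q) → IsModule T (pair q r) → IsModule T (pair q s) →
                       p ≢ q → r ≢ q → s ≢ q → p ≢ r → p ≢ s → r ≢ s → ⊥
  pairModules-noStar {p} {q} {r} {s} mpq mqr mqs p≢q r≢q s≢q p≢r p≢s r≢s =
    Boolₚ.not-¬ r→q≡q→r (arc-flip (≢-sym r≢q))
    where
    r→q≡q→r : arc T r q ≡ arc T q r
    r→q≡q→r = trans (proj₁ (pairModules-orient (subst (IsModule T) pair-comm mqr) mqs r≢q (≢-sym s≢q) r≢s))
                (trans (sym (proj₁ (pairModules-orient mpq mqs p≢q (≢-sym s≢q) p≢s)))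
                  (proj₁ (pairModules-orient mpq mqr p≢q (≢-sym r≢q) p≢r)))

  pairModules-noTriangle : {p q r : Fin n} → IsModule T (pair p q) → IsModule T (pair q r) → IsModule T (pair r p) →
                           p ≢ q → q ≢ r → p ≢ r → ⊥
  pairModules-noTriangle {p} {q} {r} mpq mqr mrp p≢q q≢r p≢r = Boolₚ.not-¬ p→r≡r→p (arc-flip (≢-sym p≢r))
    where
    pqr : arc T p q ≡ arc T q r × arc T p r ≡ arc T p q
    pqr = pairModules-orient mpq mqr p≢q q≢r p≢r
    p→r≡r→p : arc T p r ≡ arc T r p
    p→r≡r→p = trans (proj₂ pqr) (trans (proj₁ pqr) (proj₁ (pairModules-orient mqr mrp q≢r (≢-sym p≢r) (≢-sym p≢q))))

  -- Paths of pair modules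

  -- A path p 0, …, p (3 + k) of distinct vertices whose consecutive pairs are minimal co-modules and modules;
  -- by pairModules-orient all arcs between its vertices then point the same way, recorded by α.
  record Path : Set where
    constructor mkPath
    field
      k : ℕ
      p : ℕ → Fin n
      α : Bool
      p-injective : ∀ {i j} → i ≤ 3 + k → j ≤ 3 + k → p i ≡ p j → i ≡ j
      edge-minimal : ∀ i → i < 3 + k → MinimalCoModule T (pair (p i) (p (suc i)))
      edge-module : ∀ i → i < 3 + k → IsModule T (pair (p i) (p (suc i)))
      oriented : ∀ {i j} → i < j → j ≤ 3 + k → arc T (p i) (p j) ≡ α

  module _ (P : Path) where
    open Path P

    LeftMaximal : Set
    LeftMaximal = ∀ y → y ≢ p 1 → MinimalCoModule T (pair y (p 0)) → y ≢ p 0 → ⊥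

    RightMaximal : Set
    RightMaximal = ∀ y → y ≢ p (2 + k) → MinimalCoModule T (pair (p (3 + k)) y) → y ≢ p (3 + k) → ⊥

    OnPath : Fin n → Set
    OnPath x = ∃ λ i → i ≤ 3 + k × p i ≡ x

  reverse : Path → Path
  reverse (mkPath k p α p-injective edge-minimal edge-module oriented) =
    mkPath k (λ i → p (L ∸ i)) (not α) injective minimal module′ oriented′
    where
    L : ℕ
    L = 3 + k
    L∸i≡suc[L∸suc[i]] : ∀ {i} → i < L → L ∸ i ≡ suc (L ∸ suc i)
    L∸i≡suc[L∸suc[i]] i<L = ℕₚ.+-∸-assoc 1 i<L
    reversed-edge : ∀ {i} → i < L → pair (p (L ∸ suc i)) (p (suc (L ∸ suc i))) ≡ pair (p (L ∸ i)) (p (L ∸ suc i))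
    reversed-edge {i} i<L = trans pair-comm (cong (λ j → pair (p j) (p (L ∸ suc i))) (sym (L∸i≡suc[L∸suc[i]] i<L)))
    L∸suc[i]<L : ∀ {i} → i < L → L ∸ suc i < L
    L∸suc[i]<L {i} i<L = subst (_≤ L) (L∸i≡suc[L∸suc[i]] i<L) (ℕₚ.m∸n≤m L i)
    injective : ∀ {i j} → i ≤ L → j ≤ L → p (L ∸ i) ≡ p (L ∸ j) → i ≡ j
    injective {i} {j} i≤L j≤L e =
      trans (sym (ℕₚ.m∸[m∸n]≡n i≤L))
        (trans (cong (L ∸_) (p-injective (ℕₚ.m∸n≤m L i) (ℕₚ.m∸n≤m L j) e)) (ℕₚ.m∸[m∸n]≡n j≤L))
    minimal : ∀ i → i < L → MinimalCoModule T (pair (p (L ∸ i)) (p (L ∸ suc i)))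
    minimal i i<L = subst (MinimalCoModule T) (reversed-edge i<L) (edge-minimal (L ∸ suc i) (L∸suc[i]<L i<L))
    module′ : ∀ i → i < L → IsModule T (pair (p (L ∸ i)) (p (L ∸ suc i)))
    module′ i i<L = subst (IsModule T) (reversed-edge i<L) (edge-module (L ∸ suc i) (L∸suc[i]<L i<L))
    oriented′ : ∀ {i j} → i < j → j ≤ L → arc T (p (L ∸ i)) (p (L ∸ j)) ≡ not α
    oriented′ {i} {j} i<j j≤L =
      let L∸j<L∸i = ℕₚ.∸-monoʳ-< i<j j≤L
      in trans (arc-flip (λ e → ℕₚ.<-irrefl (p-injective (ℕₚ.m∸n≤m L j) (ℕₚ.m∸n≤m L i) e) L∸j<L∸i))
               (cong not (oriented L∸j<L∸i (ℕₚ.m∸n≤m L i)))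

  OnPath-reverse : (P : Path) {x : Fin n} → OnPath P x → OnPath (reverse P) x
  OnPath-reverse P (i , i≤L , e) = (3 + Path.k P ∸ i) , ℕₚ.m∸n≤m _ i , trans (cong (Path.p P) (ℕₚ.m∸[m∸n]≡n i≤L)) e

  reverse-rightMaximal : (P : Path) → LeftMaximal P → RightMaximal (reverse P)
  reverse-rightMaximal P leftMax y y≢ mc y≢last =
    leftMax y (λ e → y≢ (trans e (cong p (sym (ℕₚ.m+n∸n≡m 1 k)))))
              (subst (MinimalCoModule T) (trans pair-comm (cong (λ i → pair y (p i)) (ℕₚ.n∸n≡0 (3 + k)))) mc)
              (λ e → y≢last (trans e (cong p (sym (ℕₚ.n∸n≡0 (3 + k))))))
    where open Path P

  reverse-leftMaximal : (P : Path) → RightMaximal P → LeftMaximal (reverse P)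
  reverse-leftMaximal P rightMax y y≢ mc y≢first = rightMax y y≢ (subst (MinimalCoModule T) pair-comm mc) y≢first

  prepend : (P : Path) (y : Fin n) → y ≢ Path.p P 1 → MinimalCoModule T (pair y (Path.p P 0)) → y ≢ Path.p P 0 → Path
  prepend (mkPath k p α p-injective edge-minimal edge-module oriented) y y≢p1 mc y≢p0 =
    mkPath (suc k) p′ α injective minimal module′ oriented′
    where
    L : ℕ
    L = 3 + k
    p′ : ℕ → Fin n
    p′ zero = y
    p′ (suc i) = p i
    p0≢p : ∀ {l} → suc l ≤ L → p 0 ≢ p (suc l)
    p0≢p l≤L e = ℕₚ.0≢1+n (p-injective z≤n l≤L e)
    y-p0-module : IsModule T (pair y (p 0))
    y-p0-module = proj₁ (overlap⇒nontrivialModule mc (proj₁ (edge-minimal 0 (s≤s z≤n)))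
      ( (p 0 , x∈p∩q⁺ (y∈pair , x∈pair))
      , (y , x∈p∧x∉q⇒x∈p─q x∈pair (∉-pair y≢p0 y≢p1))
      , (p 1 , x∈p∧x∉q⇒x∈p─q y∈pair (∉-pair (≢-sym y≢p1) (≢-sym (p0≢p (s≤s z≤n)))))))
    orient : arc T y (p 0) ≡ arc T (p 0) (p 1) × arc T y (p 1) ≡ arc T y (p 0)
    orient = pairModules-orient y-p0-module (edge-module 0 (s≤s z≤n)) y≢p0 (p0≢p (s≤s z≤n)) y≢p1
    y→p0 : arc T y (p 0) ≡ α
    y→p0 = trans (proj₁ orient) (oriented (s≤s z≤n) (s≤s z≤n))
    y≢p : ∀ {l} → l ≤ L → y ≢ p l
    y≢p {zero} _ = y≢p0
    y≢p {suc zero} _ = y≢p1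
    y≢p {suc (suc l)} l≤L y≡p = Boolₚ.not-¬ refl (trans (sym p→p0) (trans (arc-flip (p0≢p l≤L)) (cong not (oriented (s≤s z≤n) l≤L))))
      where
      p→p0 : arc T (p (suc (suc l))) (p 0) ≡ α
      p→p0 = subst (λ z → arc T z (p 0) ≡ α) y≡p y→p0
    y→p : ∀ {l} → suc l ≤ L → arc T y (p (suc l)) ≡ α
    y→p {l} l≤L = begin
      arc T y (p (suc l))              ≡⟨ arc-flip (≢-sym (y≢p l≤L)) ⟩
      not (arc T (p (suc l)) y)        ≡⟨ cong not (isModule⇒arc≡ y-p0-module x∈pair y∈pair (∉-pair (≢-sym (y≢p l≤L)) (≢-sym (p0≢p l≤L)))) ⟩
      not (arc T (p (suc l)) (p 0))    ≡⟨ cong not (arc-flip (p0≢p l≤L)) ⟩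
      not (not (arc T (p 0) (p (suc l)))) ≡⟨ Boolₚ.not-involutive _ ⟩
      arc T (p 0) (p (suc l))          ≡⟨ oriented (s≤s z≤n) l≤L ⟩
      α                                ∎
      where open ≡-Reasoning
    injective : ∀ {i j} → i ≤ suc L → j ≤ suc L → p′ i ≡ p′ j → i ≡ j
    injective {zero} {zero} _ _ _ = refl
    injective {zero} {suc j} _ j≤ e = ⊥-elim (y≢p (ℕₚ.≤-pred j≤) e)
    injective {suc i} {zero} i≤ _ e = ⊥-elim (y≢p (ℕₚ.≤-pred i≤) (sym e))
    injective {suc i} {suc j} i≤ j≤ e = cong suc (p-injective (ℕₚ.≤-pred i≤) (ℕₚ.≤-pred j≤) e)
    minimal : ∀ i → i < suc L → MinimalCoModule T (pair (p′ i) (p′ (suc i)))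
    minimal zero _ = mc
    minimal (suc i) i< = edge-minimal i (ℕₚ.≤-pred i<)
    module′ : ∀ i → i < suc L → IsModule T (pair (p′ i) (p′ (suc i)))
    module′ zero _ = y-p0-module
    module′ (suc i) i< = edge-module i (ℕₚ.≤-pred i<)
    oriented′ : ∀ {i j} → i < j → j ≤ suc L → arc T (p′ i) (p′ j) ≡ α
    oriented′ {zero} {suc zero} _ _ = y→p0
    oriented′ {zero} {suc (suc j)} _ j≤ = y→p (ℕₚ.≤-pred j≤)
    oriented′ {suc i} {suc j} i<j j≤ = oriented (ℕₚ.≤-pred i<j) (ℕₚ.≤-pred j≤)

  path-length-bound : (P : Path) → suc (3 + Path.k P) ≤ n
  path-length-bound P with n ℕ.≤? 3 + Path.k P
  ... | no n≰ = ℕₚ.≰⇒> n≰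
  ... | yes n≤ with Finₚ.pigeonhole (s≤s n≤) (λ i → Path.p P (Fin.toℕ i))
  ...   | (i , j , i<j , e) =
    ⊥-elim (ℕₚ.<-irrefl (Path.p-injective P (ℕₚ.≤-pred (Finₚ.toℕ<n i)) (ℕₚ.≤-pred (Finₚ.toℕ<n j)) e) i<j)

  -- The fuel bound holds since every prepend lengthens the path, which has at most n vertices.
  extendLeft : (fuel : ℕ) (P : Path) → n ≤ 3 + Path.k P + fuel →
               Σ Path λ P′ → LeftMaximal P′ × (RightMaximal P → RightMaximal P′) × (∀ {x} → OnPath P x → OnPath P′ x)
  extendLeft fuel P n≤ with Finₚ.any? (λ y → ¬? (y Fin.≟ Path.p P 1) ×-dec minimalCoModule? (pair y (Path.p P 0))
                                         ×-dec ¬? (y Fin.≟ Path.p P 0))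
  ... | no none = P , (λ y y≢p1 mc y≢p0 → none (y , y≢p1 , mc , y≢p0)) , (λ r → r) , (λ o → o)
  ... | yes (y , y≢p1 , mc , y≢p0) with fuel
  ...   | zero = ⊥-elim (ℕₚ.≤⇒≯ (subst (n ≤_) (ℕₚ.+-identityʳ _) n≤)
                                  (ℕₚ.<⇒≤ (path-length-bound (prepend P y y≢p1 mc y≢p0))))
  ...   | suc fuel′ with extendLeft fuel′ (prepend P y y≢p1 mc y≢p0) (subst (n ≤_) (ℕₚ.+-suc _ fuel′) n≤)
  ...     | (P′ , leftMax , keepRight , keepOn) =
    P′ , leftMax , keepRight , (λ (i , i≤ , e) → keepOn (suc i , s≤s i≤ , e))

  record MaximalPath : Set where
    constructor maximal
    field
      path : Path
      leftMaximal : LeftMaximal path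
      rightMaximal : RightMaximal path

  maximalPath-through : (P : Path) → Σ MaximalPath λ P′ → ∀ {x} → OnPath P x → OnPath (MaximalPath.path P′) x
  maximalPath-through P with extendLeft n P (ℕₚ.m≤n+m n _)
  ... | (P₁ , leftMax₁ , _ , on₁) with extendLeft n (reverse P₁) (ℕₚ.m≤n+m n _)
  ...   | (P₂ , leftMax₂ , keepRight₂ , on₂) =
    maximal P₂ leftMax₂ (keepRight₂ (reverse-rightMaximal P₁ leftMax₁)) , (λ o → on₂ (OnPath-reverse P₁ (on₁ o)))

  fourPath : {v₀ v₁ v₂ v₃ : Fin n} →
    IsModule T (pair v₀ v₁) → IsModule T (pair v₁ v₂) → IsModule T (pair v₂ v₃) →
    MinimalCoModule T (pair v₀ v₁) → MinimalCoModule T (pair v₁ v₂) → MinimalCoModule T (pair v₂ v₃) →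
    v₀ ≢ v₁ → v₁ ≢ v₂ → v₂ ≢ v₃ → v₀ ≢ v₂ → v₁ ≢ v₃ → Path
  fourPath {v₀} {v₁} {v₂} {v₃} m₀₁ m₁₂ m₂₃ mc₀₁ mc₁₂ mc₂₃ v₀≢v₁ v₁≢v₂ v₂≢v₃ v₀≢v₂ v₁≢v₃ =
    mkPath 0 v α (<-distinct⇒injective distinct) minimal module′ oriented
    where
    v : ℕ → Fin n
    v 0 = v₀
    v 1 = v₁
    v 2 = v₂
    v (suc (suc (suc _))) = v₃
    v₀≢v₃ : v₀ ≢ v₃
    v₀≢v₃ refl = pairModules-noTriangle m₀₁ m₁₂ m₂₃ v₀≢v₁ v₁≢v₂ v₀≢v₂
    distinct : ∀ {i j} → i < j → j ≤ 3 → v i ≢ v j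
    distinct {0} {1} _ _ = v₀≢v₁
    distinct {0} {2} _ _ = v₀≢v₂
    distinct {0} {3} _ _ = v₀≢v₃
    distinct {1} {2} _ _ = v₁≢v₂
    distinct {1} {3} _ _ = v₁≢v₃
    distinct {2} {3} _ _ = v₂≢v₃
    distinct {_} {0} () _
    distinct {1} {1} (s≤s ()) _
    distinct {2} {1} (s≤s ()) _
    distinct {2} {2} (s≤s (s≤s ())) _
    distinct {suc (suc (suc _))} {1} (s≤s ()) _
    distinct {suc (suc (suc _))} {2} (s≤s (s≤s ())) _
    distinct {suc (suc (suc _))} {3} (s≤s (s≤s (s≤s ()))) _
    distinct {_} {suc (suc (suc (suc _)))} _ (s≤s (s≤s (s≤s ())))
    minimal : ∀ i → i < 3 → MinimalCoModule T (pair (v i) (v (suc i)))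
    minimal 0 _ = mc₀₁
    minimal 1 _ = mc₁₂
    minimal 2 _ = mc₂₃
    minimal (suc (suc (suc _))) (s≤s (s≤s (s≤s ())))
    module′ : ∀ i → i < 3 → IsModule T (pair (v i) (v (suc i)))
    module′ 0 _ = m₀₁
    module′ 1 _ = m₁₂
    module′ 2 _ = m₂₃
    module′ (suc (suc (suc _))) (s≤s (s≤s (s≤s ())))
    α : Bool
    α = arc T v₀ v₁
    orient₀₁₂ : arc T v₀ v₁ ≡ arc T v₁ v₂ × arc T v₀ v₂ ≡ arc T v₀ v₁
    orient₀₁₂ = pairModules-orient m₀₁ m₁₂ v₀≢v₁ v₁≢v₂ v₀≢v₂
    orient₁₂₃ : arc T v₁ v₂ ≡ arc T v₂ v₃ × arc T v₁ v₃ ≡ arc T v₁ v₂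
    orient₁₂₃ = pairModules-orient m₁₂ m₂₃ v₁≢v₂ v₂≢v₃ v₁≢v₃
    v₂→v₃ : arc T v₂ v₃ ≡ α
    v₂→v₃ = trans (sym (proj₁ orient₁₂₃)) (sym (proj₁ orient₀₁₂))
    v₀→v₃ : arc T v₀ v₃ ≡ α
    v₀→v₃ = begin
      arc T v₀ v₃              ≡⟨ arc-flip (≢-sym v₀≢v₃) ⟩
      not (arc T v₃ v₀)        ≡⟨ cong not (isModule⇒arc≡ m₀₁ x∈pair y∈pair (∉-pair (≢-sym v₀≢v₃) (≢-sym v₁≢v₃))) ⟩
      not (arc T v₃ v₁)        ≡⟨ cong not (isModule⇒arc≡ m₁₂ x∈pair y∈pair (∉-pair (≢-sym v₁≢v₃) (≢-sym v₂≢v₃))) ⟩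
      not (arc T v₃ v₂)        ≡⟨ cong not (arc-flip v₂≢v₃) ⟩
      not (not (arc T v₂ v₃))  ≡⟨ Boolₚ.not-involutive _ ⟩
      arc T v₂ v₃              ≡⟨ v₂→v₃ ⟩
      α                        ∎
      where open ≡-Reasoning
    oriented : ∀ {i j} → i < j → j ≤ 3 → arc T (v i) (v j) ≡ α
    oriented {0} {1} _ _ = refl
    oriented {0} {2} _ _ = proj₂ orient₀₁₂
    oriented {0} {3} _ _ = v₀→v₃
    oriented {1} {2} _ _ = sym (proj₁ orient₀₁₂)
    oriented {1} {3} _ _ = trans (proj₂ orient₁₂₃) (sym (proj₁ orient₀₁₂))
    oriented {2} {3} _ _ = v₂→v₃
    oriented {_} {0} () _
    oriented {1} {1} (s≤s ()) _
    oriented {2} {1} (s≤s ()) _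
    oriented {2} {2} (s≤s (s≤s ())) _
    oriented {suc (suc (suc _))} {1} (s≤s ()) _
    oriented {suc (suc (suc _))} {2} (s≤s (s≤s ())) _
    oriented {suc (suc (suc _))} {3} (s≤s (s≤s (s≤s ()))) _
    oriented {_} {suc (suc (suc (suc _)))} _ (s≤s (s≤s (s≤s ())))

  -- The two overlapping minimal co-modules hang on different vertices of M, giving a path of three edges.
  twoOverlaps⇒path : {M : Subset n} → MinimalCoModule T M → TwoOverlaps M → Σ Path λ P → ∃ λ x → x ∈ M × OnPath P x
  twoOverlaps⇒path {M} mcM (N₁ , N₂ , (mc₁ , ov₁) , (mc₂ , ov₂) , N₁≢N₂)
    with overlap⇒pairs mcM mc₁ ov₁ | overlap⇒pairs mcM mc₂ ov₂
  ... | pairOverlap x b c₁ x≢b b≢c₁ x≢c₁ refl refl ntM ntN₁ | pairOverlap x′ b′ c₂ x′≢b′ b′≢c₂ x′≢c₂ M≡x′b′ refl _ ntN₂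
    with ∈-pair⁻ (subst (b′ ∈_) (sym M≡x′b′) y∈pair) | ∈-pair⁻ (subst (x′ ∈_) (sym M≡x′b′) x∈pair)
  ... | inj₂ refl | inj₁ refl =
    ⊥-elim (pairModules-noStar (proj₁ ntM) (proj₁ ntN₁) (proj₁ ntN₂) x≢b (≢-sym b≢c₁) (≢-sym b′≢c₂) x≢c₁ x′≢c₂ c₁≢c₂)
    where
    c₁≢c₂ : c₁ ≢ c₂
    c₁≢c₂ refl = N₁≢N₂ refl
  ... | inj₂ refl | inj₂ refl = ⊥-elim (x′≢b′ refl)
  ... | inj₁ refl | inj₁ refl = ⊥-elim (x′≢b′ refl)
  ... | inj₁ refl | inj₂ refl =
    fourPath (subst (IsModule T) pair-comm (proj₁ ntN₁)) (subst (IsModule T) pair-comm (proj₁ ntM)) (proj₁ ntN₂)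
             (subst (MinimalCoModule T) pair-comm mc₁) (subst (MinimalCoModule T) pair-comm mcM) mc₂
             (≢-sym b≢c₁) (≢-sym x≢b) b′≢c₂ (≢-sym x≢c₁) x′≢c₂
    , x , x∈pair , 2 , s≤s (s≤s z≤n) , refl

  module PathSet (P : Path) where
    open Path P public

    L : ℕ
    L = 3 + k

    edge : ℕ → Subset n
    edge s = pair (p s) (p (suc s))

    prefix : ℕ → Subset n
    prefix zero = ⁅ p 0 ⁆
    prefix (suc j) = prefix j ∪ ⁅ p (suc j) ⁆

    Q : Subset n
    Q = prefix L

    p∈prefix : ∀ {i j} → i ≤ j → p i ∈ prefix j
    p∈prefix {zero} {zero} _ = x∈⁅x⁆ _
    p∈prefix {i} {suc j} i≤ with ℕₚ.m≤n⇒m<n∨m≡n i≤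
    ... | inj₁ i< = x∈p∪q⁺ (inj₁ (p∈prefix (ℕₚ.≤-pred i<)))
    ... | inj₂ refl = x∈p∪q⁺ (inj₂ (x∈⁅x⁆ _))

    prefix⁻ : ∀ {x} j → x ∈ prefix j → ∃ λ i → i ≤ j × p i ≡ x
    prefix⁻ zero h = 0 , z≤n , sym (x∈⁅y⁆⇒x≡y _ h)
    prefix⁻ (suc j) h with x∈p∪q⁻ (prefix j) ⁅ p (suc j) ⁆ h
    ... | inj₁ h′ = let (i , i≤ , e) = prefix⁻ j h′ in i , ℕₚ.m≤n⇒m≤1+n i≤ , e
    ... | inj₂ h′ = suc j , ℕₚ.≤-refl , sym (x∈⁅y⁆⇒x≡y _ h′)

    p∈Q : ∀ {i} → i ≤ L → p i ∈ Q
    p∈Q = p∈prefix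

    Q⁻ : ∀ {x} → x ∈ Q → OnPath P x
    Q⁻ = prefix⁻ L

    edge⊆Q : ∀ {s} → s < L → edge s ⊆ Q
    edge⊆Q s<L h with ∈-pair⁻ h
    ... | inj₁ refl = p∈Q (ℕₚ.<⇒≤ s<L)
    ... | inj₂ refl = p∈Q s<L

    p-≢ : ∀ {i j} → i ≤ L → j ≤ L → i ≢ j → p i ≢ p j
    p-≢ i≤ j≤ i≢j e = i≢j (p-injective i≤ j≤ e)

    1≤L : 1 ≤ L
    1≤L = s≤s z≤n

    2≤L : 2 ≤ L
    2≤L = s≤s (s≤s z≤n)

    outside-arc≡ : ∀ {v} → v ∉ Q → ∀ i → i ≤ L → arc T v (p i) ≡ arc T v (p 0)
    outside-arc≡ v∉Q zero _ = refl
    outside-arc≡ v∉Q (suc i) i< =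
      trans (sym (isModule⇒arc≡ (edge-module i i<) x∈pair y∈pair (λ h → v∉Q (edge⊆Q i< h)))) (outside-arc≡ v∉Q i (ℕₚ.<⇒≤ i<))

    Q-isModule : IsModule T Q
    Q-isModule = isModule⁺ λ x y v x∈Q y∈Q v∉Q →
      let (i , i≤ , pi≡x) = Q⁻ x∈Q ; (j , j≤ , pj≡y) = Q⁻ y∈Q in
      trans (cong (arc T v) (sym pi≡x))
        (trans (outside-arc≡ v∉Q i i≤) (trans (sym (outside-arc≡ v∉Q j j≤)) (cong (arc T v) pj≡y)))

    -- Otherwise ∁ ⁅ p 0 ⁆ would be a nontrivial module (all arcs from p 0 have value α),
    -- making ⁅ p 0 ⁆ a co-module strictly inside the minimal co-module edge 0.
    Q-proper : ∃ λ z → z ∉ Q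
    Q-proper with nonempty? (∁ Q)
    ... | yes (z , z∈∁Q) = z , x∈∁p⇒x∉p z∈∁Q
    ... | no Q-full = ⊥-elim (p-≢ 1≤L z≤n (λ ()) (x∈⁅y⁆⇒x≡y _ (subst (p 1 ∈_) (sym ⁅p0⁆≡edge0) y∈pair)))
      where
      p0→ : ∀ u → u ≢ p 0 → arc T (p 0) u ≡ α
      p0→ u u≢p0 with Q⁻ (x∉∁p⇒x∈p (λ h → Q-full (u , h)))
      ... | (zero , _ , e) = ⊥-elim (u≢p0 (sym e))
      ... | (suc j , j≤ , refl) = oriented (s≤s z≤n) j≤
      S : Subset n
      S = ∁ ⁅ p 0 ⁆
      ∈S : ∀ {u} → u ≢ p 0 → u ∈ S
      ∈S u≢p0 = x∉p⇒x∈∁p (λ h → u≢p0 (x∈⁅y⁆⇒x≡y _ h))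
      ∈S⁻ : ∀ {u} → u ∈ S → u ≢ p 0
      ∈S⁻ h e = x∈∁p⇒x∉p h (subst (_∈ ⁅ p 0 ⁆) (sym e) (x∈⁅x⁆ _))
      S-module : IsModule T S
      S-module = isModule⁺ λ x y v x∈S y∈S v∉S →
        let v≡p0 = x∈⁅y⁆⇒x≡y _ (x∉∁p⇒x∈p v∉S) in
        trans (cong (λ w → arc T w x) v≡p0)
          (trans (p0→ x (∈S⁻ x∈S)) (sym (trans (cong (λ w → arc T w y) v≡p0) (p0→ y (∈S⁻ y∈S)))))
      S-nontrivial : NontrivialModule T S
      S-nontrivial = nontrivial⁺ S-module (∈S (p-≢ 1≤L z≤n (λ ()))) (∈S (p-≢ 2≤L z≤n (λ ()))) (p-≢ 1≤L 2≤L (λ ()))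
                       (λ h → x∈∁p⇒x∉p h (x∈⁅x⁆ _))
      ⁅p0⁆≡edge0 : ⁅ p 0 ⁆ ≡ edge 0
      ⁅p0⁆≡edge0 = proj₂ (edge-minimal 0 1≤L) ⁅ p 0 ⁆ (inj₂ S-nontrivial)
                     (λ h → subst (_∈ edge 0) (sym (x∈⁅y⁆⇒x≡y _ h)) x∈pair)

    ∁Q-coModule : CoModule T (∁ Q)
    ∁Q-coModule = inj₂ (subst (NontrivialModule T) (sym (∁-involutive Q))
                          (nontrivial⁺ Q-isModule (p∈Q {0} z≤n) (p∈Q 1≤L) (p-≢ z≤n 1≤L (λ ())) (proj₂ Q-proper)))

    edges-meet : ∀ {s t z} → s < L → t < L → z ∈ edge s → z ∈ edge t → s ≡ t ⊎ suc s ≡ t ⊎ suc t ≡ s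
    edges-meet s<L t<L z∈s z∈t with ∈-pair⁻ z∈s | ∈-pair⁻ z∈t
    ... | inj₁ refl | inj₁ e = inj₁ (p-injective (ℕₚ.<⇒≤ s<L) (ℕₚ.<⇒≤ t<L) e)
    ... | inj₁ refl | inj₂ e = inj₂ (inj₂ (sym (p-injective (ℕₚ.<⇒≤ s<L) t<L e)))
    ... | inj₂ refl | inj₁ e = inj₂ (inj₁ (p-injective s<L (ℕₚ.<⇒≤ t<L) e))
    ... | inj₂ refl | inj₂ e = inj₁ (ℕₚ.suc-injective (p-injective s<L t<L e))

    vertex-in-edge : ∀ {j t} → j ≤ L → t < L → p j ∈ edge t → j ≡ t ⊎ j ≡ suc t
    vertex-in-edge j≤ t< h = Sum.map (p-injective j≤ (ℕₚ.<⇒≤ t<)) (p-injective j≤ t<) (∈-pair⁻ h)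

    edge-injective : ∀ {s t} → s < L → t < L → edge s ≡ edge t → s ≡ t
    edge-injective {s} {t} s< t< e with vertex-in-edge (ℕₚ.<⇒≤ s<) t< (subst (p s ∈_) e x∈pair)
                                      | vertex-in-edge s< t< (subst (p (suc s) ∈_) e y∈pair)
    ... | inj₁ s≡t | _ = s≡t
    ... | inj₂ refl | inj₁ e′ = ⊥-elim (ℕₚ.<⇒≢ (ℕₚ.m<n⇒m<1+n (ℕₚ.n<1+n t)) (sym e′))
    ... | inj₂ refl | inj₂ e′ = ⊥-elim (ℕₚ.<⇒≢ (ℕₚ.n<1+n (suc t)) (sym e′))

    edge⁻ : ∀ {s u} → u ∈ edge s → ∃ λ j → (j ≡ s ⊎ j ≡ suc s) × p j ≡ u
    edge⁻ {s} h with ∈-pair⁻ h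
    ... | inj₁ refl = s , inj₁ refl , refl
    ... | inj₂ refl = suc s , inj₂ refl , refl

    edges-disjoint : ∀ {s t} → suc s < t → t < L → Disjoint T (edge s) (edge t)
    edges-disjoint {s} {t} s+1<t t<L z z∈s z∈t with edges-meet (ℕₚ.<-trans (ℕₚ.<-trans (ℕₚ.n<1+n s) s+1<t) t<L) t<L z∈s z∈t
    ... | inj₁ refl = ℕₚ.<-irrefl refl (ℕₚ.<-trans (ℕₚ.n<1+n s) s+1<t)
    ... | inj₂ (inj₁ refl) = ℕₚ.<-irrefl refl s+1<t
    ... | inj₂ (inj₂ refl) = ℕₚ.<-irrefl refl (ℕₚ.<-trans (ℕₚ.<-trans (ℕₚ.n<1+n _) (ℕₚ.n<1+n _)) s+1<t)

    edges-oriented : ∀ {s t} → suc s < t → t < L → ∀ u v → u ∈ edge s → v ∈ edge t → arc T u v ≡ α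
    edges-oriented {s} {t} s+1<t t<L u v u∈ v∈ with edge⁻ u∈ | edge⁻ v∈
    ... | (j , j≡ , refl) | (j′ , j′≡ , refl) = oriented (ordered j≡ j′≡) (bounded j′≡)
      where
      ordered : (j ≡ s ⊎ j ≡ suc s) → (j′ ≡ t ⊎ j′ ≡ suc t) → j < j′
      ordered (inj₁ refl) (inj₁ refl) = ℕₚ.<-trans (ℕₚ.n<1+n s) s+1<t
      ordered (inj₁ refl) (inj₂ refl) = ℕₚ.<-trans (ℕₚ.<-trans (ℕₚ.n<1+n s) s+1<t) (ℕₚ.n<1+n t)
      ordered (inj₂ refl) (inj₁ refl) = s+1<t
      ordered (inj₂ refl) (inj₂ refl) = ℕₚ.<-trans s+1<t (ℕₚ.n<1+n t)
      bounded : (j′ ≡ t ⊎ j′ ≡ suc t) → j′ ≤ L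
      bounded (inj₁ refl) = ℕₚ.<⇒≤ t<L
      bounded (inj₂ refl) = t<L

    edges-oriented⁻ : ∀ {s t} → suc s < t → t < L → ∀ u v → u ∈ edge t → v ∈ edge s → arc T u v ≡ not α
    edges-oriented⁻ s+1<t t<L u v u∈ v∈ = trans (arc-flip v≢u) (cong not (edges-oriented s+1<t t<L v u v∈ u∈))
      where
      v≢u : v ≢ u
      v≢u refl = edges-disjoint s+1<t t<L v v∈ u∈

    outside→edge : ∀ {x} → x ∉ Q → ∀ {t} → t < L → ∀ v → v ∈ edge t → arc T x v ≡ arc T x (p 0)
    outside→edge x∉Q t<L v v∈ with edge⁻ v∈
    ... | (j , inj₁ refl , refl) = outside-arc≡ x∉Q j (ℕₚ.<⇒≤ t<L)
    ... | (j , inj₂ refl , refl) = outside-arc≡ x∉Q j t<L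

    edge→outside : ∀ {x} → x ∉ Q → ∀ {t} → t < L → ∀ u → u ∈ edge t → arc T u x ≡ not (arc T x (p 0))
    edge→outside x∉Q t<L u u∈ =
      trans (arc-flip (λ e → x∉Q (edge⊆Q t<L (subst (_∈ edge _) (sym e) u∈)))) (cong not (outside→edge x∉Q t<L u u∈))

  record Neighbour (X f : Subset n) (v : Fin n) : Set where
    constructor neighbour
    field
      y : Fin n
      y≢v : y ≢ v
      y∉f : y ∉ f
      X≡yv : X ≡ pair y v
      mc : MinimalCoModule T (pair y v)
      isModule : IsModule T (pair y v)

  minimalCoModules-sharing : {X f : Subset n} {v : Fin n} → MinimalCoModule T X → MinimalCoModule T f → v ∈ X → v ∈ f →
                             X ≡ f ⊎ Neighbour X f v
  minimalCoModules-sharing {X} {f} {v} mcX mcf v∈X v∈f with f ⊆? X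
  ... | yes f⊆X = inj₁ (sym (proj₂ mcX f (proj₁ mcf) f⊆X))
  ... | no f⊈X with X ⊆? f
  ...   | yes X⊆f = inj₁ (proj₂ mcf X (proj₁ mcX) X⊆f)
  ...   | no X⊈f = inj₂ (neighbourOf (overlap⇒pairs mcX mcf ((v , x∈p∩q⁺ (v∈X , v∈f)) , ⊈⇒Nonempty─ X⊈f , ⊈⇒Nonempty─ f⊈X)))
    where
    neighbourOf : PairOverlap X f → Neighbour X f v
    neighbourOf (pairOverlap a b c a≢b b≢c a≢c refl f≡bc ntX _) =
      neighbour a a≢v a∉f (cong (pair a) b≡v) (subst (MinimalCoModule T) (cong (pair a) b≡v) mcX)
                (subst (IsModule T) (cong (pair a) b≡v) (proj₁ ntX))
      where
      a∉f : a ∉ f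
      a∉f h = Sum.[ a≢b , a≢c ] (∈-pair⁻ (subst (a ∈_) f≡bc h))
      b≡v : b ≡ v
      b≡v with ∈-pair⁻ v∈X
      ... | inj₁ refl = ⊥-elim (a∉f v∈f)
      ... | inj₂ v≡b = sym v≡b
      a≢v : a ≢ v
      a≢v e = a∉f (subst (_∈ f) (sym e) v∈f)

  module OnMaximalPath (MP : MaximalPath) where
    open MaximalPath MP
    open PathSet path public

    minimalCoModule-at-vertex : ∀ {X} i → i ≤ L → MinimalCoModule T X → p i ∈ X → ∃ λ s → s < L × X ≡ edge s
    minimalCoModule-at-vertex {X} zero _ mcX p0∈X = first (minimalCoModules-sharing mcX (edge-minimal 0 1≤L) p0∈X x∈pair)
      where
      first : X ≡ edge 0 ⊎ Neighbour X (edge 0) (p 0) → ∃ λ s → s < L × X ≡ edge s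
      first (inj₁ e) = 0 , 1≤L , e
      first (inj₂ (neighbour y y≢p0 y∉ _ mc _)) = ⊥-elim (leftMaximal y (λ e → y∉ (subst (_∈ edge 0) (sym e) y∈pair)) mc y≢p0)
    minimalCoModule-at-vertex {X} (suc i) i< mcX v∈X with suc i ℕ.<? L
    ... | yes i+1<L = inner (minimalCoModules-sharing mcX (edge-minimal (suc i) i+1<L) v∈X x∈pair)
      where
      inner : X ≡ edge (suc i) ⊎ Neighbour X (edge (suc i)) (p (suc i)) → ∃ λ s → s < L × X ≡ edge s
      inner (inj₁ e) = suc i , i+1<L , e
      inner (inj₂ (neighbour y y≢v y∉ X≡ _ m)) with y Fin.≟ p i
      ... | yes refl = i , ℕₚ.<⇒≤ i+1<L , X≡
      ... | no y≢pi = ⊥-elim (pairModules-noStar m (subst (IsModule T) pair-comm (edge-module i (ℕₚ.<⇒≤ i+1<L)))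
              (edge-module (suc i) i+1<L) y≢v (p-≢ (ℕₚ.<⇒≤ i<) i< (ℕₚ.<⇒≢ (ℕₚ.n<1+n i)))
              (p-≢ i+1<L i< (≢-sym (ℕₚ.<⇒≢ (ℕₚ.n<1+n _)))) y≢pi
              (λ e → y∉ (subst (_∈ edge (suc i)) (sym e) y∈pair))
              (p-≢ (ℕₚ.<⇒≤ i<) i+1<L (ℕₚ.<⇒≢ (ℕₚ.m<n⇒m<1+n (ℕₚ.n<1+n i)))))
    ... | no i+1≮L = last (minimalCoModules-sharing mcX (edge-minimal (2 + k) ℕₚ.≤-refl) v∈X
                             (subst (λ j → p j ∈ edge (2 + k)) (sym i+1≡L) y∈pair))
      where
      i+1≡L : suc i ≡ L
      i+1≡L = ℕₚ.≤∧≮⇒≡ i< i+1≮L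
      last : X ≡ edge (2 + k) ⊎ Neighbour X (edge (2 + k)) (p (suc i)) → ∃ λ s → s < L × X ≡ edge s
      last (inj₁ e) = 2 + k , ℕₚ.≤-refl , e
      last (inj₂ (neighbour y y≢v y∉ _ mc _)) =
        ⊥-elim (rightMaximal y (λ e → y∉ (subst (_∈ edge (2 + k)) (sym e) x∈pair))
                  (subst (MinimalCoModule T) (trans pair-comm (cong (λ j → pair (p j) y) i+1≡L)) mc)
                  (λ e → y≢v (trans e (cong p (sym i+1≡L)))))

    minimalCoModule-meeting-Q : ∀ {X x} → MinimalCoModule T X → x ∈ X → x ∈ Q → ∃ λ s → s < L × X ≡ edge s
    minimalCoModule-meeting-Q mcX x∈X x∈Q with Q⁻ x∈Q
    ... | (i , i≤ , refl) = minimalCoModule-at-vertex i i≤ mcX x∈X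

    O-firstEdge : ∀ {N} → O T (edge 0) N → N ≡ edge 1
    O-firstEdge {N} (mcN , ov) with overlap⇒pairs (edge-minimal 0 1≤L) mcN ov
    ... | pairOverlap a b c a≢b b≢c a≢c e0≡ab refl _ ntN = shared (∈-pair⁻ (subst (b ∈_) (sym e0≡ab) y∈pair))
      where
      c∉ : c ∉ edge 0
      c∉ h = Sum.[ (λ e → a≢c (sym e)) , (λ e → b≢c (sym e)) ] (∈-pair⁻ (subst (c ∈_) e0≡ab h))
      shared : b ≡ p 0 ⊎ b ≡ p 1 → pair b c ≡ edge 1
      shared (inj₁ refl) = ⊥-elim (leftMaximal c (λ e → c∉ (subst (_∈ edge 0) (sym e) y∈pair))
                                    (subst (MinimalCoModule T) pair-comm mcN) (≢-sym b≢c))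
      shared (inj₂ refl) with c Fin.≟ p 2
      ... | yes refl = refl
      ... | no c≢p2 = ⊥-elim (pairModules-noStar (edge-module 0 1≤L) (proj₁ ntN) (edge-module 1 2≤L)
                        (p-≢ z≤n 1≤L (λ ())) (≢-sym b≢c) (p-≢ 2≤L 1≤L (λ ()))
                        (λ e → c∉ (subst (_∈ edge 0) e x∈pair)) (p-≢ z≤n 2≤L (λ ())) c≢p2)

    firstEdge-¬TwoOverlaps : ¬ TwoOverlaps (edge 0)
    firstEdge-¬TwoOverlaps (N₁ , N₂ , o₁ , o₂ , N₁≢N₂) = N₁≢N₂ (trans (O-firstEdge o₁) (sym (O-firstEdge o₂)))

  reverseMaximal : MaximalPath → MaximalPath
  reverseMaximal (maximal P leftMax rightMax) = maximal (reverse P) (reverse-leftMaximal P rightMax) (reverse-rightMaximal P leftMax)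

  lastEdge-¬TwoOverlaps : (MP : MaximalPath) → ¬ TwoOverlaps (PathSet.edge (MaximalPath.path MP) (2 + Path.k (MaximalPath.path MP)))
  lastEdge-¬TwoOverlaps MP two = OnMaximalPath.firstEdge-¬TwoOverlaps (reverseMaximal MP) (subst TwoOverlaps pair-comm two)

  -- δ-decompositions

  Disjoint-sym : {X Y : Subset n} → Disjoint T X Y → Disjoint T Y X
  Disjoint-sym d x x∈Y x∈X = d x x∈X x∈Y

  disjointCoModules-unique : {D : List (Subset n)} → All (CoModule T) D → AllPairs (Disjoint T) D → Unique D
  disjointCoModules-unique {D} cms = AllPairs-map-∈ distinct
    where
    distinct : ∀ {X Y} → X ∈ₗ D → Y ∈ₗ D → Disjoint T X Y → X ≢ Y
    distinct X∈D _ d refl = let (z , z∈X) = coModule-nonempty (All.lookup cms X∈D) in d z z∈X z∈X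

  minimalCoModule-inside : {M : Subset n} → CoModule T M → ∃ λ N → MinimalCoModule T N × N ⊆ M
  minimalCoModule-inside {M} cM = descend (suc ∣ M ∣) M (ℕₚ.n<1+n _) cM
    where
    descend : (fuel : ℕ) (M : Subset n) → ∣ M ∣ < fuel → CoModule T M → ∃ λ N → MinimalCoModule T N × N ⊆ M
    descend (suc fuel) M ∣M∣< cM with properCoModule? M
    ... | yes (N , cN , N⊆M , N≢M) =
      let (N′ , mcN′ , N′⊆N) = descend fuel N (ℕₚ.<-≤-trans (p⊂q⇒∣p∣<∣q∣ (⊆∧≢⇒⊂ N⊆M N≢M)) (ℕₚ.≤-pred ∣M∣<)) cN
      in N′ , mcN′ , (λ h → N⊆M (N′⊆N h))
    ... | no none = M , minimalCoModule⁺ cM none , (λ h → h)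

  δ-decomposition⁺ : {D : List (Subset n)} {k : ℕ} → All (MinimalCoModule T) D → AllPairs (Disjoint T) D → length D ≡ k →
                     IsDeltaDecomposition T k D
  δ-decomposition⁺ mcs disjoint len = (disjointCoModules-unique cms disjoint , cms , disjoint) , len , mcs
    where cms = All.map proj₁ mcs

  -- Shrink each member of a maximum co-modular decomposition to a minimal co-module inside it.
  δ-decomposition-exists : {k : ℕ} → DeltaIs T k → Σ (List (Subset n)) (IsDeltaDecomposition T k)
  δ-decomposition-exists ((D , (_ , cms , disjoint) , len) , _) =
    let (D′ , len′ , mcs , disjoint′ , _) = shrink D cms disjoint in D′ , δ-decomposition⁺ mcs disjoint′ (trans len′ len)
    where
    shrink : (D : List (Subset n)) → All (CoModule T) D → AllPairs (Disjoint T) D →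
      Σ (List (Subset n)) λ D′ → length D′ ≡ length D × All (MinimalCoModule T) D′ × AllPairs (Disjoint T) D′
        × All (λ N → ∃ λ X → X ∈ₗ D × N ⊆ X) D′
    shrink [] _ _ = [] , refl , [] , [] , []
    shrink (X ∷ D) (cX ∷ cms) (dX ∷ disjoint) =
      let (N , mcN , N⊆X) = minimalCoModule-inside cX
          (D′ , len , mcs , disjoint′ , inside) = shrink D cms disjoint
          dN : All (Disjoint T N) D′
          dN = All.map (λ (X′ , X′∈D , N′⊆X′) x x∈N x∈N′ → All.lookup dX X′∈D x (N⊆X x∈N) (N′⊆X′ x∈N′)) inside
      in N ∷ D′ , cong suc len , mcN ∷ mcs , dN ∷ disjoint′
         , (X , here refl , N⊆X) ∷ All.map (λ (X′ , X′∈D , N′⊆X′) → X′ , there X′∈D , (λ {z} → N′⊆X′ {z})) inside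

  δ-disjoint : {K : ℕ} {D : List (Subset n)} {X Y : Subset n} → IsDeltaDecomposition T K D → X ∈ₗ D → Y ∈ₗ D → X ≢ Y →
               Disjoint T X Y
  δ-disjoint ((_ , _ , disjoint) , _ , _) X∈D Y∈D X≢Y with Membershipₚ.∈-AllPairs₂ disjoint X∈D Y∈D
  ... | inj₁ X≡Y = ⊥-elim (X≢Y X≡Y)
  ... | inj₂ (inj₁ d) = d
  ... | inj₂ (inj₂ d) = Disjoint-sym d

  countTwoOverlaps : List (Subset n) → ℕ
  countTwoOverlaps [] = 0
  countTwoOverlaps (X ∷ D) = suc-if (twoOverlaps? X) (countTwoOverlaps D)

  countTwoOverlaps-map-≤ : (f : Subset n → Subset n) (D : List (Subset n)) → (∀ {X} → X ∈ₗ D → TwoOverlaps (f X) → TwoOverlaps X) →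
                           countTwoOverlaps (map f D) ≤ countTwoOverlaps D
  countTwoOverlaps-map-≤ f [] _ = z≤n
  countTwoOverlaps-map-≤ f (X ∷ D) worse =
    suc-if-mono-≤ (twoOverlaps? X) (twoOverlaps? (f X)) (worse (here refl)) (countTwoOverlaps-map-≤ f D (λ m → worse (there m)))

  countTwoOverlaps-map-< : (f : Subset n → Subset n) (D : List (Subset n)) → (∀ {X} → X ∈ₗ D → TwoOverlaps (f X) → TwoOverlaps X) →
                           ∀ {M} → M ∈ₗ D → TwoOverlaps M → ¬ TwoOverlaps (f M) → countTwoOverlaps (map f D) < countTwoOverlaps D
  countTwoOverlaps-map-< f (X ∷ D) worse (here refl) two ¬two =
    suc-if-drop (twoOverlaps? X) (twoOverlaps? (f X)) two ¬two (countTwoOverlaps-map-≤ f D (λ m → worse (there m)))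
  countTwoOverlaps-map-< f (X ∷ D) worse (there M∈D) two ¬two =
    suc-if-mono-< (twoOverlaps? X) (twoOverlaps? (f X)) (worse (here refl)) (countTwoOverlaps-map-< f D (λ m → worse (there m)) M∈D two ¬two)

  module PathEdgesIn (MP : MaximalPath) {K : ℕ} {D : List (Subset n)} (dd : IsDeltaDecomposition T K D) where
    open OnMaximalPath MP public

    lastEdge : Subset n
    lastEdge = edge (2 + k)

    InD : ℕ → Set
    InD s = s < L × edge s ∈ₗ D

    inD? : ∀ s → Dec (InD s)
    inD? s = (s ℕ.<? L) ×-dec Any.any? (edge s ≟ₛ_) D

    member-meeting-Q : ∀ {Y z} → Y ∈ₗ D → z ∈ Y → z ∈ Q → ∃ λ s → InD s × Y ≡ edge s
    member-meeting-Q Y∈D z∈Y z∈Q =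
      let (s , s< , Y≡) = minimalCoModule-meeting-Q (All.lookup (proj₂ (proj₂ dd)) Y∈D) z∈Y z∈Q
      in s , (s< , subst (_∈ₗ D) Y≡ Y∈D) , Y≡

    members-nonadjacent : ∀ {s t} → InD s → InD t → suc s ≢ t
    members-nonadjacent {s} (s< , s∈) (t< , t∈) refl =
      δ-disjoint dd s∈ t∈ (λ e → ℕₚ.<⇒≢ (ℕₚ.n<1+n s) (edge-injective s< t< e)) (p (suc s)) y∈pair x∈pair

    firstEdge-disjoint-lastEdge : Disjoint T (edge 0) lastEdge
    firstEdge-disjoint-lastEdge z z∈first z∈last with edges-meet 1≤L ℕₚ.≤-refl z∈first z∈last
    ... | inj₁ ()
    ... | inj₂ (inj₁ ())
    ... | inj₂ (inj₂ ())

    member-nonempty : ∀ {X} → X ∈ₗ D → Nonempty X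
    member-nonempty X∈D = coModule-nonempty (proj₁ (All.lookup (proj₂ (proj₂ dd)) X∈D))

    -- Replacing the outermost members edge i and edge l of D on the path by the end edges of the path.
    module Outermost {s₀ : ℕ} (s₀∈ : InD s₀) where
      private
        leastMember : ∃ λ i → InD i × (∀ j → InD j → i ≤ j)
        leastMember = least inD? s₀∈
        greatestMember : ∃ λ l → InD l × (∀ j → InD j → j ≤ l)
        greatestMember = greatest inD? (2 + k) (λ j j∈ → ℕₚ.≤-pred (proj₁ j∈)) s₀∈

      i l : ℕ
      i = proj₁ leastMember
      l = proj₁ greatestMember

      i∈ : InD i
      i∈ = proj₁ (proj₂ leastMember)

      l∈ : InD l
      l∈ = proj₁ (proj₂ greatestMember)

      i-least : ∀ j → InD j → i ≤ j
      i-least = proj₂ (proj₂ leastMember)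

      l-greatest : ∀ j → InD j → j ≤ l
      l-greatest = proj₂ (proj₂ greatestMember)

      replace′ : (X : Subset n) → Dec (X ≡ edge i) → Dec (X ≡ edge l) → Subset n
      replace′ X (yes _) _ = edge 0
      replace′ X (no _) (yes _) = lastEdge
      replace′ X (no _) (no _) = X

      replace : Subset n → Subset n
      replace X = replace′ X (X ≟ₛ edge i) (X ≟ₛ edge l)

      data Replaced (X Y : Subset n) : Set where
        first : X ≡ edge i → Y ≡ edge 0 → Replaced X Y
        last : X ≢ edge i → X ≡ edge l → Y ≡ lastEdge → Replaced X Y
        kept : X ≢ edge i → X ≢ edge l → Y ≡ X → Replaced X Y

      replaced : ∀ X → Replaced X (replace X)
      replaced X = view (X ≟ₛ edge i) (X ≟ₛ edge l)
        where
        view : (i? : Dec (X ≡ edge i)) (l? : Dec (X ≡ edge l)) → Replaced X (replace′ X i? l?)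
        view (yes X≡i) _ = first X≡i refl
        view (no X≢i) (yes X≡l) = last X≢i X≡l refl
        view (no X≢i) (no X≢l) = kept X≢i X≢l refl

      D′ : List (Subset n)
      D′ = map replace D

      -- A member meeting edge 0 lies on the path at index ≥ i + 2 ≥ 2, so edge 0 misses it.
      firstEdge-disjoint : ∀ {Y} → Y ∈ₗ D → Y ≢ edge i → Disjoint T (edge i) Y → Disjoint T (edge 0) Y
      firstEdge-disjoint {Y} Y∈D Y≢i disjoint z z∈first z∈Y with member-meeting-Q Y∈D z∈Y (edge⊆Q 1≤L z∈first)
      ... | (s , s∈ , refl) = meet (edges-meet 1≤L (proj₁ s∈) z∈first z∈Y) (skipsSuccessor⇒2≤ (i-least s s∈) s≢i i+1≢s)
        where
        s≢i : s ≢ i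
        s≢i e = Y≢i (cong edge e)
        i+1≢s : suc i ≢ s
        i+1≢s e = disjoint (p (suc i)) y∈pair (subst (λ q → p (suc i) ∈ edge q) e x∈pair)
        meet : 0 ≡ s ⊎ 1 ≡ s ⊎ suc s ≡ 0 → 2 ≤ s → ⊥
        meet (inj₁ refl) ()
        meet (inj₂ (inj₁ refl)) (s≤s ())
        meet (inj₂ (inj₂ ())) _

      lastEdge-disjoint : ∀ {Y} → Y ∈ₗ D → Y ≢ edge l → Disjoint T (edge l) Y → Disjoint T lastEdge Y
      lastEdge-disjoint {Y} Y∈D Y≢l disjoint z z∈last z∈Y with member-meeting-Q Y∈D z∈Y (edge⊆Q ℕₚ.≤-refl z∈last)
      ... | (s , s∈ , refl) =
        meet (edges-meet ℕₚ.≤-refl (proj₁ s∈) z∈last z∈Y) (skipsPredecessor⇒≤ (l-greatest s s∈) s≢l s+1≢l (ℕₚ.≤-pred (proj₁ l∈)))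
        where
        s≢l : s ≢ l
        s≢l e = Y≢l (cong edge e)
        s+1≢l : suc s ≢ l
        s+1≢l e = disjoint (p l) x∈pair (subst (λ q → p q ∈ edge s) e y∈pair)
        meet : 2 + k ≡ s ⊎ 3 + k ≡ s ⊎ suc s ≡ 2 + k → s ≤ k → ⊥
        meet (inj₁ refl) s≤k = ℕₚ.<-irrefl refl (ℕₚ.<-trans (ℕₚ.n<1+n k) s≤k)
        meet (inj₂ (inj₁ refl)) s≤k = ℕₚ.<-irrefl refl (ℕₚ.<-trans (ℕₚ.n<1+n k) (ℕₚ.<-trans (ℕₚ.n<1+n _) s≤k))
        meet (inj₂ (inj₂ e)) s≤k = ℕₚ.<-irrefl (ℕₚ.suc-injective e) (s≤s s≤k)

      D′-disjoint : AllPairs (Disjoint T) D′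
      D′-disjoint = AllPairsₚ.map⁺ (AllPairs-map-∈ replaced-disjoint (proj₂ (proj₂ (proj₁ dd))))
        where
        self : ∀ {X} → X ∈ₗ D → ¬ Disjoint T X X
        self X∈D d = let (z , z∈X) = member-nonempty X∈D in d z z∈X z∈X
        replaced-disjoint : ∀ {X Y} → X ∈ₗ D → Y ∈ₗ D → Disjoint T X Y → Disjoint T (replace X) (replace Y)
        replaced-disjoint {X} {Y} X∈D Y∈D d with replaced X | replaced Y
        ... | first X≡ e₁ | first Y≡ e₂ = ⊥-elim (self X∈D (subst (Disjoint T X) (trans Y≡ (sym X≡)) d))
        ... | first X≡ e₁ | last _ Y≡ e₂ rewrite e₁ | e₂ = firstEdge-disjoint-lastEdge
        ... | first X≡ e₁ | kept Y≢ _ e₂ rewrite e₁ | e₂ = firstEdge-disjoint Y∈D Y≢ (subst (λ q → Disjoint T q Y) X≡ d)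
        ... | last _ X≡ e₁ | first Y≡ e₂ rewrite e₁ | e₂ = Disjoint-sym firstEdge-disjoint-lastEdge
        ... | last _ X≡ e₁ | last _ Y≡ e₂ = ⊥-elim (self X∈D (subst (Disjoint T X) (trans Y≡ (sym X≡)) d))
        ... | last _ X≡ e₁ | kept _ Y≢ e₂ rewrite e₁ | e₂ = lastEdge-disjoint Y∈D Y≢ (subst (λ q → Disjoint T q Y) X≡ d)
        ... | kept X≢ _ e₁ | first Y≡ e₂ rewrite e₁ | e₂ =
          Disjoint-sym (firstEdge-disjoint X∈D X≢ (subst (λ q → Disjoint T q X) Y≡ (Disjoint-sym d)))
        ... | kept _ X≢ e₁ | last _ Y≡ e₂ rewrite e₁ | e₂ =
          Disjoint-sym (lastEdge-disjoint X∈D X≢ (subst (λ q → Disjoint T q X) Y≡ (Disjoint-sym d)))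
        ... | kept _ _ e₁ | kept _ _ e₂ rewrite e₁ | e₂ = d

      D′-minimal : All (MinimalCoModule T) D′
      D′-minimal = Allₚ.map⁺ (All.tabulate (λ {X} X∈D → minimal X (All.lookup (proj₂ (proj₂ dd)) X∈D)))
        where
        minimal : ∀ X → MinimalCoModule T X → MinimalCoModule T (replace X)
        minimal X mcX with replaced X
        ... | first _ e = subst (MinimalCoModule T) (sym e) (edge-minimal 0 1≤L)
        ... | last _ _ e = subst (MinimalCoModule T) (sym e) (edge-minimal (2 + k) ℕₚ.≤-refl)
        ... | kept _ _ e = subst (MinimalCoModule T) (sym e) mcX

      D′-δ-decomposition : IsDeltaDecomposition T K D′
      D′-δ-decomposition = δ-decomposition⁺ D′-minimal D′-disjoint (trans (Listₚ.length-map replace D) (proj₁ (proj₂ dd)))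

      firstEdge∈D′ : edge 0 ∈ₗ D′
      firstEdge∈D′ with replaced (edge i)
      ... | first _ e = subst (_∈ₗ D′) e (Membershipₚ.∈-map⁺ replace (proj₂ i∈))
      ... | last i≢i _ _ = ⊥-elim (i≢i refl)
      ... | kept i≢i _ _ = ⊥-elim (i≢i refl)

      lastEdge∈D′ : i ≢ l → lastEdge ∈ₗ D′
      lastEdge∈D′ i≢l with replaced (edge l)
      ... | first l≡i _ = ⊥-elim (i≢l (sym (edge-injective (proj₁ l∈) (proj₁ i∈) l≡i)))
      ... | last _ _ e = subst (_∈ₗ D′) e (Membershipₚ.∈-map⁺ replace (proj₂ l∈))
      ... | kept _ l≢l _ = ⊥-elim (l≢l refl)

      kept∈D′ : ∀ {X} → X ∈ₗ D → X ≢ edge i → X ≢ edge l → X ∈ₗ D′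
      kept∈D′ {X} X∈D X≢i X≢l with replaced X
      ... | first X≡i _ = ⊥-elim (X≢i X≡i)
      ... | last _ X≡l _ = ⊥-elim (X≢l X≡l)
      ... | kept _ _ e = subst (_∈ₗ D′) e (Membershipₚ.∈-map⁺ replace X∈D)

      middle? : (∃ λ s → i < s × s < l × InD s) ⊎ (∀ s → i < s → s < l → ¬ InD s)
      middle? with Finₚ.any? (λ (s : Fin l) → (i ℕ.<? Fin.toℕ s) ×-dec inD? (Fin.toℕ s))
      ... | yes (s , i<s , s∈) = inj₁ (Fin.toℕ s , i<s , Finₚ.toℕ<n s , s∈)
      ... | no none = inj₂ λ s i<s s<l s∈ →
        none (Fin.fromℕ< s<l , subst (i <_) (sym (Finₚ.toℕ-fromℕ< s<l)) i<s , subst InD (sym (Finₚ.toℕ-fromℕ< s<l)) s∈)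

      record Middle : Set where
        constructor middle
        field
          s : ℕ
          2≤s : 2 ≤ s
          s≤k : s ≤ k
          edge∈D′ : edge s ∈ₗ D′
          i≢l : i ≢ l

      middle⁺ : ∀ s → i < s → s < l → InD s → Middle
      middle⁺ s i<s s<l s∈ =
        middle s (skipsSuccessor⇒2≤ (i-least s s∈) s≢i (members-nonadjacent i∈ s∈))
                 (skipsPredecessor⇒≤ (l-greatest s s∈) s≢l (members-nonadjacent s∈ l∈) (ℕₚ.≤-pred (proj₁ l∈)))
                 (kept∈D′ (proj₂ s∈) (λ e → s≢i (edge-injective (proj₁ s∈) (proj₁ i∈) e))
                                      (λ e → s≢l (edge-injective (proj₁ s∈) (proj₁ l∈) e)))
                 (λ e → ℕₚ.<-irrefl e (ℕₚ.<-trans i<s s<l))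
        where
        s≢i : s ≢ i
        s≢i e = ℕₚ.<-irrefl (sym e) i<s
        s≢l : s ≢ l
        s≢l e = ℕₚ.<-irrefl e s<l

      TwoOverlaps-replace⁻ : ∀ {X} → TwoOverlaps (replace X) → TwoOverlaps X
      TwoOverlaps-replace⁻ {X} two with replaced X
      ... | first _ e = ⊥-elim (firstEdge-¬TwoOverlaps (subst TwoOverlaps e two))
      ... | last _ _ e = ⊥-elim (lastEdge-¬TwoOverlaps MP (subst TwoOverlaps e two))
      ... | kept _ _ e = subst TwoOverlaps e two

      -- Without a middle member, a member M meeting the path is edge i or edge l, which are replaced.
      count-decreases : (∀ s → i < s → s < l → ¬ InD s) → ∀ {M z} → M ∈ₗ D → TwoOverlaps M → z ∈ M → z ∈ Q →
                        countTwoOverlaps D′ < countTwoOverlaps D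
      count-decreases none {M} M∈D two z∈M z∈Q with member-meeting-Q M∈D z∈M z∈Q
      ... | (s , s∈ , M≡s) = countTwoOverlaps-map-< replace D (λ _ → TwoOverlaps-replace⁻) M∈D two ¬two
        where
        extreme : s ≡ i ⊎ s ≡ l
        extreme with ℕₚ.m≤n⇒m<n∨m≡n (i-least s s∈) | ℕₚ.m≤n⇒m<n∨m≡n (l-greatest s s∈)
        ... | inj₂ i≡s | _ = inj₁ (sym i≡s)
        ... | inj₁ _ | inj₂ s≡l = inj₂ s≡l
        ... | inj₁ i<s | inj₁ s<l = ⊥-elim (none s i<s s<l s∈)
        ¬two : ¬ TwoOverlaps (replace M)
        ¬two two′ with replaced M
        ... | first _ e = firstEdge-¬TwoOverlaps (subst TwoOverlaps e two′)
        ... | last _ _ e = lastEdge-¬TwoOverlaps MP (subst TwoOverlaps e two′)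
        ... | kept M≢i M≢l _ = Sum.[ (λ s≡i → M≢i (trans M≡s (cong edge s≡i))) , (λ s≡l → M≢l (trans M≡s (cong edge s≡l))) ] extreme

    -- Otherwise every member is a path edge inside Q, and adjoining ∁ Q would beat Δ(T) = K.
    member-outside-Q : DeltaIs T K → ∃ λ Y → Y ∈ₗ D × (∀ z → z ∈ Y → z ∉ Q)
    member-outside-Q Δ≡K with Any.any? (λ Y → Finₚ.all? (λ z → (z ∈? Y) →-dec ¬? (z ∈? Q))) D
    ... | yes outside = find outside
    ... | no none = ⊥-elim (ℕₚ.<-irrefl refl (ℕₚ.<-≤-trans (subst (K <_) (sym E-length) (ℕₚ.n<1+n K)) (proj₂ Δ≡K E E-decomposition)))
      where
      all-coModule : All (CoModule T) D
      all-coModule = proj₁ (proj₂ (proj₁ dd))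
      disjoint : AllPairs (Disjoint T) D
      disjoint = proj₂ (proj₂ (proj₁ dd))
      member⊆Q : ∀ {Y} → Y ∈ₗ D → Y ⊆ Q
      member⊆Q {Y} Y∈D with nonempty? (Y ∩ Q)
      ... | yes (z , z∈Y∩Q) = let (s , s∈ , Y≡) = member-meeting-Q Y∈D (proj₁ (x∈p∩q⁻ Y Q z∈Y∩Q)) (proj₂ (x∈p∩q⁻ Y Q z∈Y∩Q))
                              in λ h → edge⊆Q (proj₁ s∈) (subst (_ ∈_) Y≡ h)
      ... | no empty = ⊥-elim (none (Any.map (λ { refl z z∈Y z∈Q → empty (z , x∈p∩q⁺ (z∈Y , z∈Q)) }) Y∈D))
      E : List (Subset n)
      E = D ++ (∁ Q ∷ [])
      E-length : length E ≡ suc K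
      E-length = trans (Listₚ.length-++ D) (trans (ℕₚ.+-comm (length D) 1) (cong suc (proj₁ (proj₂ dd))))
      E-coModules : All (CoModule T) E
      E-coModules = Allₚ.++⁺ all-coModule (∁Q-coModule ∷ [])
      E-disjoint : AllPairs (Disjoint T) E
      E-disjoint = AllPairsₚ.++⁺ disjoint ([] ∷ [])
                     (All.tabulate (λ Y∈D → (λ z z∈Y z∈∁Q → x∈p⇒x∉∁p (member⊆Q Y∈D z∈Y) z∈∁Q) ∷ []))
      E-decomposition : CoModularDecomposition T E
      E-decomposition = disjointCoModules-unique E-coModules E-disjoint , E-coModules , E-disjoint

  GoodQuadruple : List (Subset n) → Set
  GoodQuadruple D = ∃ λ M₁ → ∃ λ M₂ → ∃ λ M₃ → ∃ λ M₄ →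
      (M₁ ∈ₗ D × M₂ ∈ₗ D × M₃ ∈ₗ D × M₄ ∈ₗ D)
    × (M₁ ≢ M₂ × M₁ ≢ M₃ × M₁ ≢ M₄ × M₂ ≢ M₃ × M₂ ≢ M₄ × M₃ ≢ M₄)
    × (oLeq T M₁ 1 × oLeq T M₃ 1 × oLeq T M₄ 1)
    × ((∀ u v → u ∈ M₁ → v ∈ M₂ → Arc T u v) × (∀ u v → u ∈ M₂ → v ∈ M₃ → Arc T u v))
    × (∃ λ x → x ∈ M₄ × ((∀ v → v ∈ M₁ → Arc T x v) ⊎ (∀ u → u ∈ M₃ → Arc T u x)))

  twoOverlaps⇒maximalPath : ∀ {M} → MinimalCoModule T M → TwoOverlaps M →
                            Σ MaximalPath λ MP → ∃ λ z → z ∈ M × z ∈ PathSet.Q (MaximalPath.path MP)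
  twoOverlaps⇒maximalPath mcM two =
    let (P , z , z∈M , on) = twoOverlaps⇒path mcM two
        (MP , through) = maximalPath-through P
        (j , j≤ , pj≡z) = through on
    in MP , z , z∈M , subst (_∈ PathSet.Q (MaximalPath.path MP)) pj≡z (PathSet.p∈Q (MaximalPath.path MP) j≤)

  -- The path edges 0, s, 2 + k are consecutive in the orientation α (or ¬ α), and a vertex x outside Q
  -- sees all of Q the same way.
  quadruple-from-path : (MP : MaximalPath) → let open OnMaximalPath MP in
    ∀ {D} → edge 0 ∈ₗ D → ∀ s → 2 ≤ s → s ≤ k → edge s ∈ₗ D → edge (2 + k) ∈ₗ D →
    ∀ {Y x} → Y ∈ₗ D → x ∈ Y → x ∉ Q → ¬ TwoOverlaps Y → GoodQuadruple D
  quadruple-from-path MP {D} first∈ s 2≤s s≤k s∈ last∈ {Y} {x} Y∈ x∈Y x∉Q ¬twoY = orient α refl (arc T x (p 0)) refl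
    where
    open OnMaximalPath MP
    s<L : s < L
    s<L = ℕₚ.≤-trans (s≤s s≤k) (ℕₚ.≤-trans (ℕₚ.n≤1+n _) (ℕₚ.n≤1+n _))
    last<L : 2 + k < L
    last<L = ℕₚ.≤-refl
    s+1<last : suc s < 2 + k
    s+1<last = s≤s (s≤s s≤k)
    first≢s : edge 0 ≢ edge s
    first≢s e with edge-injective 1≤L s<L e
    ... | refl = ℕₚ.<-irrefl refl (ℕₚ.<-trans (s≤s z≤n) 2≤s)
    s≢last : edge s ≢ edge (2 + k)
    s≢last e with edge-injective s<L last<L e
    ... | refl = ℕₚ.<-irrefl refl (ℕₚ.<-trans (ℕₚ.n<1+n k) s≤k)
    first≢last : edge 0 ≢ edge (2 + k)
    first≢last e with edge-injective 1≤L last<L e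
    ... | ()
    edge≢Y : ∀ {t} → t < L → edge t ≢ Y
    edge≢Y t<L e = x∉Q (edge⊆Q t<L (subst (x ∈_) (sym e) x∈Y))
    o-first : oLeq T (edge 0) 1
    o-first = ¬TwoOverlaps⇒o≤1 firstEdge-¬TwoOverlaps
    o-last : oLeq T (edge (2 + k)) 1
    o-last = ¬TwoOverlaps⇒o≤1 (lastEdge-¬TwoOverlaps MP)
    o-Y : oLeq T Y 1
    o-Y = ¬TwoOverlaps⇒o≤1 ¬twoY
    orient : (b : Bool) → α ≡ b → (c : Bool) → arc T x (p 0) ≡ c → GoodQuadruple D
    orient true α≡ c x→p0 =
      edge 0 , edge s , edge (2 + k) , Y , (first∈ , s∈ , last∈ , Y∈)
      , (first≢s , first≢last , edge≢Y 1≤L , s≢last , edge≢Y s<L , edge≢Y last<L)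
      , (o-first , o-last , o-Y)
      , ((λ u v u∈ v∈ → trans (edges-oriented 2≤s s<L u v u∈ v∈) α≡)
        , (λ u v u∈ v∈ → trans (edges-oriented s+1<last last<L u v u∈ v∈) α≡))
      , (x , x∈Y , endpoints c x→p0)
      where
      endpoints : (c : Bool) → arc T x (p 0) ≡ c → (∀ v → v ∈ edge 0 → Arc T x v) ⊎ (∀ u → u ∈ edge (2 + k) → Arc T u x)
      endpoints true e = inj₁ (λ v v∈ → trans (outside→edge x∉Q 1≤L v v∈) e)
      endpoints false e = inj₂ (λ u u∈ → trans (edge→outside x∉Q last<L u u∈) (cong not e))
    orient false α≡ c x→p0 =
      edge (2 + k) , edge s , edge 0 , Y , (last∈ , s∈ , first∈ , Y∈)
      , (≢-sym s≢last , ≢-sym first≢last , edge≢Y last<L , ≢-sym first≢s , edge≢Y s<L , edge≢Y 1≤L)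
      , (o-last , o-first , o-Y)
      , ((λ u v u∈ v∈ → trans (edges-oriented⁻ s+1<last last<L u v u∈ v∈) (cong not α≡))
        , (λ u v u∈ v∈ → trans (edges-oriented⁻ 2≤s s<L u v u∈ v∈) (cong not α≡)))
      , (x , x∈Y , endpoints c x→p0)
      where
      endpoints : (c : Bool) → arc T x (p 0) ≡ c → (∀ v → v ∈ edge (2 + k) → Arc T x v) ⊎ (∀ u → u ∈ edge 0 → Arc T u x)
      endpoints true e = inj₁ (λ v v∈ → trans (outside→edge x∉Q last<L v v∈) e)
      endpoints false e = inj₂ (λ u u∈ → trans (edge→outside x∉Q 1≤L u u∈) (cong not e))

  -- Members overlapped at most once

  Dominates : Subset n → Subset n → Set
  Dominates A B = ∀ u v → u ∈ A → v ∈ B → Arc T u v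

  disjointModules-comparable : ∀ {X Y} → NontrivialModule T X → NontrivialModule T Y → Disjoint T X Y →
                               Dominates X Y ⊎ Dominates Y X
  disjointModules-comparable {X} {Y} ntX ntY disjoint = compare (arc T a b) refl
    where
    open NontrivialWitness (nontrivial⁻ ntX) using () renaming (x₁ to a; x₁∈ to a∈)
    open NontrivialWitness (nontrivial⁻ ntY) using () renaming (x₁ to b; x₁∈ to b∈)
    from : ∀ {X Y a b} → NontrivialModule T X → NontrivialModule T Y → Disjoint T X Y → a ∈ X → b ∈ Y →
           arc T a b ≡ true → Dominates X Y
    from {X} {Y} {a} {b} ntX ntY d a∈ b∈ a→b u v u∈ v∈ =
      trans (isModule⇒arc≡ (proj₁ ntY) v∈ b∈ (d u u∈))
        (trans (arc-flip (λ e → d u u∈ (subst (_∈ Y) e b∈)))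
          (trans (cong not (isModule⇒arc≡ (proj₁ ntX) u∈ a∈ (λ h → d b h b∈)))
            (trans (cong not (arc-flip (λ e → d a a∈ (subst (_∈ Y) (sym e) b∈)))) (trans (Boolₚ.not-involutive _) a→b))))
    compare : (c : Bool) → arc T a b ≡ c → Dominates X Y ⊎ Dominates Y X
    compare true a→b = inj₁ (from ntX ntY disjoint a∈ b∈ a→b)
    compare false a↛b = inj₂ (from ntY ntX (Disjoint-sym disjoint) b∈ a∈
                               (trans (arc-flip (λ e → disjoint a a∈ (subst (_∈ Y) (sym e) b∈))) (cong not a↛b)))

  Source Sink : Subset n → Fin n → Set
  Source X x = ∀ v → v ∈ ∁ X → Arc T x v
  Sink X x = ∀ v → v ∈ ∁ X → Arc T v x

  sourceOrSink : ∀ {X x} → NontrivialModule T (∁ X) → x ∈ X → Source X x ⊎ Sink X x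
  sourceOrSink {X} {x} nt∁X x∈X = compare (arc T x w) refl
    where
    open NontrivialWitness (nontrivial⁻ nt∁X) using () renaming (x₁ to w; x₁∈ to w∈)
    x∉∁X : x ∉ ∁ X
    x∉∁X = x∈p⇒x∉∁p x∈X
    compare : (c : Bool) → arc T x w ≡ c → Source X x ⊎ Sink X x
    compare true e = inj₁ (λ v v∈ → trans (isModule⇒arc≡ (proj₁ nt∁X) v∈ w∈ x∉∁X) e)
    compare false e = inj₂ (λ v v∈ → trans (arc-flip (λ q → x∉∁X (subst (_∈ ∁ X) (sym q) v∈)))
                                           (cong not (trans (isModule⇒arc≡ (proj₁ nt∁X) v∈ w∈ x∉∁X) e)))

  ¬twoSources : ∀ {X Y x y} → Disjoint T X Y → x ∈ X → y ∈ Y → Source X x → Source Y y → ⊥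
  ¬twoSources {X} {Y} {x} {y} d x∈ y∈ sx sy with trans (sym (sy x (x∉p⇒x∈∁p (d x x∈)))) (asym T x y (sx y (x∉p⇒x∈∁p (λ h → d y h y∈))))
  ... | ()

  ¬twoSinks : ∀ {X Y x y} → Disjoint T X Y → x ∈ X → y ∈ Y → Sink X x → Sink Y y → ⊥
  ¬twoSinks {X} {Y} {x} {y} d x∈ y∈ sx sy with trans (sym (asym T y x (sx y (x∉p⇒x∈∁p (λ h → d y h y∈))))) (sy x (x∉p⇒x∈∁p (d x x∈)))
  ... | ()

  ComplementType : Subset n → Set
  ComplementType X = ¬ NontrivialModule T X × NontrivialModule T (∁ X)

  -- X = ∁ Y ─ ∁ X is a module.
  disjointComplementTypes-subsingleton : ∀ {X Y y} → ComplementType X → ComplementType Y → Disjoint T X Y → y ∈ Y →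
                                         ∀ {u v} → u ∈ X → v ∈ X → u ≡ v
  disjointComplementTypes-subsingleton {X} {Y} {y} (¬ntX , nt∁X) (_ , nt∁Y) d y∈ {u} {v} u∈ v∈ with u Fin.≟ v
  ... | yes u≡v = u≡v
  ... | no u≢v = ⊥-elim (¬ntX (nontrivial⁺ X-module u∈ v∈ u≢v (λ h → d y h y∈)))
    where
    ∁Y─∁X≡X : ∁ Y ─ ∁ X ≡ X
    ∁Y─∁X≡X = ⊆-antisym (λ h → x∉∁p⇒x∈p (x∈p─q⇒x∉q (∁ Y) (∁ X) h)) (λ {z} h → x∈p∧x∉q⇒x∈p─q (x∉p⇒x∈∁p (d z h)) (x∈p⇒x∉∁p h))
    X-module : IsModule T X
    X-module = subst (IsModule T) ∁Y─∁X≡X (─-isModule (proj₁ nt∁Y) (proj₁ nt∁X) (x∉p⇒x∈∁p (λ h → d y h y∈)) (x∈p⇒x∉∁p y∈))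

  minimalCoModule-kind : ∀ {X} → MinimalCoModule T X → NontrivialModule T X ⊎ ComplementType X
  minimalCoModule-kind {X} mcX with nontrivialModule? X
  ... | yes ntX = inj₁ ntX
  ... | no ¬ntX = Sum.map (λ ntX → ⊥-elim (¬ntX ntX)) (¬ntX ,_) (proj₁ mcX)

  module FourGoodMembers {D : List (Subset n)} (A : Fin 4 → Subset n) (A∈ : ∀ i → A i ∈ₗ D)
    (disjoint : ∀ i j → i ≢ j → Disjoint T (A i) (A j)) (minimal : ∀ i → MinimalCoModule T (A i))
    (¬two : ∀ i → ¬ TwoOverlaps (A i)) where

    𝟘 𝟙 𝟚 𝟛 : Fin 4
    𝟘 = Fin.zero
    𝟙 = Fin.suc Fin.zero
    𝟚 = Fin.suc (Fin.suc Fin.zero)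
    𝟛 = Fin.suc (Fin.suc (Fin.suc Fin.zero))

    A-injective : ∀ {i j} → i ≢ j → A i ≢ A j
    A-injective {i} {j} i≢j e = let (z , z∈) = coModule-nonempty (proj₁ (minimal i)) in disjoint i j i≢j z z∈ (subst (z ∈_) e z∈)

    nonempty : ∀ i → Nonempty (A i)
    nonempty i = coModule-nonempty (proj₁ (minimal i))

    ∈∁ : ∀ {i j} → i ≢ j → ∀ {v} → v ∈ A j → v ∈ ∁ (A i)
    ∈∁ {i} {j} i≢j v∈ = x∉p⇒x∈∁p (λ h → disjoint i j i≢j _ h v∈)

    quadruple : ∀ i₁ i₂ i₃ i₄ → i₁ ≢ i₂ → i₁ ≢ i₃ → i₁ ≢ i₄ → i₂ ≢ i₃ → i₂ ≢ i₄ → i₃ ≢ i₄ →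
                Dominates (A i₁) (A i₂) → Dominates (A i₂) (A i₃) →
                (∃ λ x → x ∈ A i₄ × ((∀ v → v ∈ A i₁ → Arc T x v) ⊎ (∀ u → u ∈ A i₃ → Arc T u x))) → GoodQuadruple D
    quadruple i₁ i₂ i₃ i₄ i₁≢i₂ i₁≢i₃ i₁≢i₄ i₂≢i₃ i₂≢i₄ i₃≢i₄ d₁₂ d₂₃ x =
      A i₁ , A i₂ , A i₃ , A i₄ , (A∈ i₁ , A∈ i₂ , A∈ i₃ , A∈ i₄)
      , (A-injective i₁≢i₂ , A-injective i₁≢i₃ , A-injective i₁≢i₄ , A-injective i₂≢i₃ , A-injective i₂≢i₄ , A-injective i₃≢i₄)
      , (¬TwoOverlaps⇒o≤1 (¬two i₁) , ¬TwoOverlaps⇒o≤1 (¬two i₃) , ¬TwoOverlaps⇒o≤1 (¬two i₄)) , (d₁₂ , d₂₃) , x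

    OneOf : Fin 4 → Fin 4 → Fin 4 → Fin 4 → Set
    OneOf i j k p = p ≡ i ⊎ p ≡ j ⊎ p ≡ k

    OneOf-≢ : ∀ {i j k c p} → i ≢ c → j ≢ c → k ≢ c → OneOf i j k p → p ≢ c
    OneOf-≢ i≢c _ _ (inj₁ refl) = i≢c
    OneOf-≢ _ j≢c _ (inj₂ (inj₁ refl)) = j≢c
    OneOf-≢ _ _ k≢c (inj₂ (inj₂ refl)) = k≢c

    isFirst : ∀ {i j k} → OneOf i j k i
    isFirst = inj₁ refl

    isSecond : ∀ {i j k} → OneOf i j k j
    isSecond = inj₂ (inj₁ refl)

    isThird : ∀ {i j k} → OneOf i j k k
    isThird = inj₂ (inj₂ refl)

    record DominationPath (i j k : Fin 4) : Set where
      constructor dominationPath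
      field
        a b c : Fin 4
        a∈ : OneOf i j k a
        b∈ : OneOf i j k b
        c∈ : OneOf i j k c
        a≢b : a ≢ b
        b≢c : b ≢ c
        a≢c : a ≢ c
        a⇒b : Dominates (A a) (A b)
        b⇒c : Dominates (A b) (A c)

    -- Three pairwise comparable modules can be lined up, as in any tournament on three vertices.
    dominationPath⁺ : ∀ i j k → i ≢ j → j ≢ k → i ≢ k → NontrivialModule T (A i) → NontrivialModule T (A j) →
                      NontrivialModule T (A k) → DominationPath i j k
    dominationPath⁺ i j k i≢j j≢k i≢k nti ntj ntk
      with disjointModules-comparable nti ntj (disjoint i j i≢j) | disjointModules-comparable ntj ntk (disjoint j k j≢k)
         | disjointModules-comparable nti ntk (disjoint i k i≢k)
    ... | inj₁ i⇒j | inj₁ j⇒k | _ = dominationPath i j k isFirst isSecond isThird i≢j j≢k i≢k i⇒j j⇒k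
    ... | inj₁ i⇒j | inj₂ k⇒j | inj₁ i⇒k = dominationPath i k j isFirst isThird isSecond i≢k (≢-sym j≢k) i≢j i⇒k k⇒j
    ... | inj₁ i⇒j | inj₂ k⇒j | inj₂ k⇒i = dominationPath k i j isThird isFirst isSecond (≢-sym i≢k) i≢j (≢-sym j≢k) k⇒i i⇒j
    ... | inj₂ j⇒i | inj₁ j⇒k | inj₁ i⇒k = dominationPath j i k isSecond isFirst isThird (≢-sym i≢j) i≢k j≢k j⇒i i⇒k
    ... | inj₂ j⇒i | inj₁ j⇒k | inj₂ k⇒i = dominationPath j k i isSecond isThird isFirst j≢k (≢-sym i≢k) (≢-sym i≢j) j⇒k k⇒i
    ... | inj₂ j⇒i | inj₂ k⇒j | _ = dominationPath k j i isThird isSecond isFirst (≢-sym j≢k) (≢-sym i≢j) (≢-sym i≢k) k⇒j j⇒i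

    oneComplementType : ∀ c r₁ r₂ r₃ → r₁ ≢ r₂ → r₂ ≢ r₃ → r₁ ≢ r₃ → r₁ ≢ c → r₂ ≢ c → r₃ ≢ c →
      ComplementType (A c) → NontrivialModule T (A r₁) → NontrivialModule T (A r₂) → NontrivialModule T (A r₃) → GoodQuadruple D
    oneComplementType c r₁ r₂ r₃ r₁≢r₂ r₂≢r₃ r₁≢r₃ r₁≢c r₂≢c r₃≢c (_ , nt∁c) nt₁ nt₂ nt₃
      with dominationPath⁺ r₁ r₂ r₃ r₁≢r₂ r₂≢r₃ r₁≢r₃ nt₁ nt₂ nt₃ | nonempty c
    ... | dominationPath a b d a∈ b∈ d∈ a≢b b≢d a≢d a⇒b b⇒d | (x , x∈) =
      quadruple a b d c a≢b a≢d a≢c b≢d b≢c d≢c a⇒b b⇒d (x , x∈ , Sum.map source sink (sourceOrSink nt∁c x∈))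
      where
      a≢c : a ≢ c
      a≢c = OneOf-≢ r₁≢c r₂≢c r₃≢c a∈
      b≢c : b ≢ c
      b≢c = OneOf-≢ r₁≢c r₂≢c r₃≢c b∈
      d≢c : d ≢ c
      d≢c = OneOf-≢ r₁≢c r₂≢c r₃≢c d∈
      source : Source (A c) x → ∀ v → v ∈ A a → Arc T x v
      source s v v∈ = s v (∈∁ (≢-sym a≢c) v∈)
      sink : Sink (A c) x → ∀ u → u ∈ A d → Arc T u x
      sink s u u∈ = s u (∈∁ (≢-sym d≢c) u∈)

    noComplementType : NontrivialModule T (A 𝟘) → NontrivialModule T (A 𝟙) → NontrivialModule T (A 𝟚) →
                       NontrivialModule T (A 𝟛) → GoodQuadruple D
    noComplementType nt₀ nt₁ nt₂ nt₃ with dominationPath⁺ 𝟘 𝟙 𝟚 (λ ()) (λ ()) (λ ()) nt₀ nt₁ nt₂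
    ... | dominationPath a b c a∈ b∈ c∈ a≢b b≢c a≢c a⇒b b⇒c = attach (nonempty 𝟛)
      where
      a≢3 : a ≢ 𝟛
      a≢3 = OneOf-≢ (λ ()) (λ ()) (λ ()) a∈
      b≢3 : b ≢ 𝟛
      b≢3 = OneOf-≢ (λ ()) (λ ()) (λ ()) b∈
      c≢3 : c ≢ 𝟛
      c≢3 = OneOf-≢ (λ ()) (λ ()) (λ ()) c∈
      nt : ∀ {i} → OneOf 𝟘 𝟙 𝟚 i → NontrivialModule T (A i)
      nt (inj₁ refl) = nt₀
      nt (inj₂ (inj₁ refl)) = nt₁
      nt (inj₂ (inj₂ refl)) = nt₂
      attach : Nonempty (A 𝟛) → GoodQuadruple D
      attach (x , x∈) with disjointModules-comparable nt₃ (nt a∈) (disjoint 𝟛 a (≢-sym a≢3))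
      ... | inj₁ 3⇒a = quadruple a b c 𝟛 a≢b a≢c a≢3 b≢c b≢3 c≢3 a⇒b b⇒c (x , x∈ , inj₁ (λ v v∈ → 3⇒a x v x∈ v∈))
      ... | inj₂ a⇒3 with disjointModules-comparable (nt c∈) nt₃ (disjoint c 𝟛 c≢3)
      ...   | inj₁ c⇒3 = quadruple a b c 𝟛 a≢b a≢c a≢3 b≢c b≢3 c≢3 a⇒b b⇒c (x , x∈ , inj₂ (λ u u∈ → c⇒3 u x u∈ x∈))
      ...   | inj₂ 3⇒c with nonempty a | disjointModules-comparable nt₃ (nt b∈) (disjoint 𝟛 b (≢-sym b≢3))
      ...     | (y , y∈) | inj₁ 3⇒b = quadruple 𝟛 b c a (≢-sym b≢3) (≢-sym c≢3) (≢-sym a≢3) b≢c (≢-sym a≢b) (≢-sym a≢c)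
                                          3⇒b b⇒c (y , y∈ , inj₁ (λ v v∈ → a⇒3 y v y∈ v∈))
      ...     | (y , y∈) | inj₂ b⇒3 = quadruple b 𝟛 c a b≢3 b≢c (≢-sym a≢b) (≢-sym c≢3) (≢-sym a≢3) (≢-sym a≢c)
                                          b⇒3 3⇒c (y , y∈ , inj₁ (λ v v∈ → a⇒b y v y∈ v∈))

    -- Of two disjoint complement types one is a source and the other a sink; the latter is a singleton.
    twoComplementTypes-ordered : ∀ c c′ u₁ u₂ → c ≢ c′ → c ≢ u₁ → c ≢ u₂ → c′ ≢ u₁ → c′ ≢ u₂ → u₁ ≢ u₂ →
      ComplementType (A c) → ComplementType (A c′) → Dominates (A u₁) (A u₂) → GoodQuadruple D
    twoComplementTypes-ordered c c′ u₁ u₂ c≢c′ c≢u₁ c≢u₂ c′≢u₁ c′≢u₂ u₁≢u₂ ct ct′ u₁⇒u₂ with nonempty c | nonempty c′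
    ... | (x , x∈) | (y , y∈) with sourceOrSink (proj₂ ct) x∈ | sourceOrSink (proj₂ ct′) y∈
    ...   | inj₁ sx | inj₁ sy = ⊥-elim (¬twoSources (disjoint c c′ c≢c′) x∈ y∈ sx sy)
    ...   | inj₂ sx | inj₂ sy = ⊥-elim (¬twoSinks (disjoint c c′ c≢c′) x∈ y∈ sx sy)
    ...   | inj₁ sx | inj₂ sy =
      quadruple u₁ u₂ c′ c u₁≢u₂ (≢-sym c′≢u₁) (≢-sym c≢u₁) (≢-sym c′≢u₂) (≢-sym c≢u₂) (≢-sym c≢c′) u₁⇒u₂
        (λ u v u∈ v∈ → subst (Arc T u) (sym (only-y v∈)) (sy u (∈∁ c′≢u₂ u∈)))
        (x , x∈ , inj₁ (λ v v∈ → sx v (∈∁ c≢u₁ v∈)))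
      where
      only-y : ∀ {v} → v ∈ A c′ → v ≡ y
      only-y v∈ = disjointComplementTypes-subsingleton ct′ ct (disjoint c′ c (≢-sym c≢c′)) x∈ v∈ y∈
    ...   | inj₂ sx | inj₁ sy =
      quadruple c′ u₁ u₂ c c′≢u₁ c′≢u₂ (≢-sym c≢c′) u₁≢u₂ (≢-sym c≢u₁) (≢-sym c≢u₂)
        (λ u v u∈ v∈ → subst (λ w → Arc T w v) (sym (only-y u∈)) (sy v (∈∁ c′≢u₁ v∈))) u₁⇒u₂
        (x , x∈ , inj₂ (λ u u∈ → sx u (∈∁ c≢u₂ u∈)))
      where
      only-y : ∀ {v} → v ∈ A c′ → v ≡ y
      only-y v∈ = disjointComplementTypes-subsingleton ct′ ct (disjoint c′ c (≢-sym c≢c′)) x∈ v∈ y∈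

    twoComplementTypes : ∀ c c′ m₁ m₂ → c ≢ c′ → c ≢ m₁ → c ≢ m₂ → c′ ≢ m₁ → c′ ≢ m₂ → m₁ ≢ m₂ →
      ComplementType (A c) → ComplementType (A c′) → NontrivialModule T (A m₁) → NontrivialModule T (A m₂) → GoodQuadruple D
    twoComplementTypes c c′ m₁ m₂ c≢c′ c≢m₁ c≢m₂ c′≢m₁ c′≢m₂ m₁≢m₂ ct ct′ nt₁ nt₂
      with disjointModules-comparable nt₁ nt₂ (disjoint m₁ m₂ m₁≢m₂)
    ... | inj₁ m₁⇒m₂ = twoComplementTypes-ordered c c′ m₁ m₂ c≢c′ c≢m₁ c≢m₂ c′≢m₁ c′≢m₂ m₁≢m₂ ct ct′ m₁⇒m₂
    ... | inj₂ m₂⇒m₁ = twoComplementTypes-ordered c c′ m₂ m₁ c≢c′ c≢m₂ c≢m₁ c′≢m₂ c′≢m₁ (≢-sym m₁≢m₂) ct ct′ m₂⇒m₁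

    ¬threeComplementTypes : ∀ c c′ c″ → c ≢ c′ → c ≢ c″ → c′ ≢ c″ →
      ComplementType (A c) → ComplementType (A c′) → ComplementType (A c″) → ⊥
    ¬threeComplementTypes c c′ c″ c≢c′ c≢c″ c′≢c″ ct ct′ ct″ with nonempty c | nonempty c′ | nonempty c″
    ... | (x , x∈) | (y , y∈) | (w , w∈) with sourceOrSink (proj₂ ct) x∈ | sourceOrSink (proj₂ ct′) y∈ | sourceOrSink (proj₂ ct″) w∈
    ...   | inj₁ sx | inj₁ sy | _ = ¬twoSources (disjoint c c′ c≢c′) x∈ y∈ sx sy
    ...   | inj₂ sx | inj₂ sy | _ = ¬twoSinks (disjoint c c′ c≢c′) x∈ y∈ sx sy
    ...   | inj₁ sx | inj₂ _ | inj₁ sw = ¬twoSources (disjoint c c″ c≢c″) x∈ w∈ sx sw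
    ...   | inj₁ _ | inj₂ sy | inj₂ sw = ¬twoSinks (disjoint c′ c″ c′≢c″) y∈ w∈ sy sw
    ...   | inj₂ _ | inj₁ sy | inj₁ sw = ¬twoSources (disjoint c′ c″ c′≢c″) y∈ w∈ sy sw
    ...   | inj₂ sx | inj₁ _ | inj₂ sw = ¬twoSinks (disjoint c c″ c≢c″) x∈ w∈ sx sw

    goodQuadruple : GoodQuadruple D
    goodQuadruple with minimalCoModule-kind (minimal 𝟘) | minimalCoModule-kind (minimal 𝟙)
                     | minimalCoModule-kind (minimal 𝟚) | minimalCoModule-kind (minimal 𝟛)
    ... | inj₁ a | inj₁ b | inj₁ c | inj₁ d = noComplementType a b c d
    ... | inj₂ a | inj₁ b | inj₁ c | inj₁ d = oneComplementType 𝟘 𝟙 𝟚 𝟛 (λ ()) (λ ()) (λ ()) (λ ()) (λ ()) (λ ()) a b c d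
    ... | inj₁ a | inj₂ b | inj₁ c | inj₁ d = oneComplementType 𝟙 𝟘 𝟚 𝟛 (λ ()) (λ ()) (λ ()) (λ ()) (λ ()) (λ ()) b a c d
    ... | inj₁ a | inj₁ b | inj₂ c | inj₁ d = oneComplementType 𝟚 𝟘 𝟙 𝟛 (λ ()) (λ ()) (λ ()) (λ ()) (λ ()) (λ ()) c a b d
    ... | inj₁ a | inj₁ b | inj₁ c | inj₂ d = oneComplementType 𝟛 𝟘 𝟙 𝟚 (λ ()) (λ ()) (λ ()) (λ ()) (λ ()) (λ ()) d a b c
    ... | inj₂ a | inj₂ b | inj₁ c | inj₁ d = twoComplementTypes 𝟘 𝟙 𝟚 𝟛 (λ ()) (λ ()) (λ ()) (λ ()) (λ ()) (λ ()) a b c d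
    ... | inj₂ a | inj₁ b | inj₂ c | inj₁ d = twoComplementTypes 𝟘 𝟚 𝟙 𝟛 (λ ()) (λ ()) (λ ()) (λ ()) (λ ()) (λ ()) a c b d
    ... | inj₂ a | inj₁ b | inj₁ c | inj₂ d = twoComplementTypes 𝟘 𝟛 𝟙 𝟚 (λ ()) (λ ()) (λ ()) (λ ()) (λ ()) (λ ()) a d b c
    ... | inj₁ a | inj₂ b | inj₂ c | inj₁ d = twoComplementTypes 𝟙 𝟚 𝟘 𝟛 (λ ()) (λ ()) (λ ()) (λ ()) (λ ()) (λ ()) b c a d
    ... | inj₁ a | inj₂ b | inj₁ c | inj₂ d = twoComplementTypes 𝟙 𝟛 𝟘 𝟚 (λ ()) (λ ()) (λ ()) (λ ()) (λ ()) (λ ()) b d a c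
    ... | inj₁ a | inj₁ b | inj₂ c | inj₂ d = twoComplementTypes 𝟚 𝟛 𝟘 𝟙 (λ ()) (λ ()) (λ ()) (λ ()) (λ ()) (λ ()) c d a b
    ... | inj₂ a | inj₂ b | inj₂ c | _ = ⊥-elim (¬threeComplementTypes 𝟘 𝟙 𝟚 (λ ()) (λ ()) (λ ()) a b c)
    ... | inj₂ a | inj₂ b | inj₁ _ | inj₂ d = ⊥-elim (¬threeComplementTypes 𝟘 𝟙 𝟛 (λ ()) (λ ()) (λ ()) a b d)
    ... | inj₂ a | inj₁ _ | inj₂ c | inj₂ d = ⊥-elim (¬threeComplementTypes 𝟘 𝟚 𝟛 (λ ()) (λ ()) (λ ()) a c d)
    ... | inj₁ _ | inj₂ b | inj₂ c | inj₂ d = ⊥-elim (¬threeComplementTypes 𝟙 𝟚 𝟛 (λ ()) (λ ()) (λ ()) b c d)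

  fourMembers⇒goodQuadruple : ∀ {K D} → IsDeltaDecomposition T K D → 4 ≤ K → All (λ M → ¬ TwoOverlaps M) D → GoodQuadruple D
  fourMembers⇒goodQuadruple {D = D} ((_ , _ , disjoint) , refl , minimal) 4≤ ¬two =
    FourGoodMembers.goodQuadruple A (λ i → Membershipₚ.∈-lookup (index i)) A-disjoint
      (λ i → All.lookup minimal (Membershipₚ.∈-lookup (index i))) (λ i → All.lookup ¬two (Membershipₚ.∈-lookup (index i)))
    where
    index : Fin 4 → Fin (length D)
    index i = Fin.inject≤ i 4≤
    A : Fin 4 → Subset n
    A i = lookup D (index i)
    A-disjoint : ∀ i j → i ≢ j → Disjoint T (A i) (A j)
    A-disjoint i j i≢j = Sum.[ (λ d → d) , Disjoint-sym ] (AllPairs-lookup disjoint (λ e → i≢j (Finₚ.inject≤-injective _ _ i j e)))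

  -- The three cases

  Δ≡2⇒o≤1 : DeltaIs T 2 → ∀ M → MinimalCoModule T M → oLeq T M 1
  Δ≡2⇒o≤1 Δ≡2 M mcM with twoOverlaps? M
  ... | no ¬two = ¬TwoOverlaps⇒o≤1 ¬two
  ... | yes two = ⊥-elim (ℕₚ.<-irrefl refl (proj₂ Δ≡2 E (disjointCoModules-unique E-coModules E-disjoint , E-coModules , E-disjoint)))
    where
    open PathSet (MaximalPath.path (proj₁ (twoOverlaps⇒maximalPath mcM two)))
    2<L : 2 < L
    2<L = s≤s (s≤s (s≤s z≤n))
    edge-disjoint-∁Q : ∀ {t} → t < L → Disjoint T (edge t) (∁ Q)
    edge-disjoint-∁Q t<L z z∈ z∈∁Q = x∈p⇒x∉∁p (edge⊆Q t<L z∈) z∈∁Q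
    E : List (Subset n)
    E = edge 0 ∷ edge 2 ∷ ∁ Q ∷ []
    E-coModules : All (CoModule T) E
    E-coModules = proj₁ (edge-minimal 0 1≤L) ∷ proj₁ (edge-minimal 2 2<L) ∷ ∁Q-coModule ∷ []
    E-disjoint : AllPairs (Disjoint T) E
    E-disjoint = (edges-disjoint (s≤s (s≤s z≤n)) 2<L ∷ edge-disjoint-∁Q 1≤L ∷ []) ∷ (edge-disjoint-∁Q 2<L ∷ []) ∷ [] ∷ []

  record ThreeMembersOnPath {K : ℕ} {D : List (Subset n)} (dd : IsDeltaDecomposition T K D) : Set where
    constructor threeMembersOnPath
    field
      MP : MaximalPath
      {s₀} : ℕ
      s₀∈ : PathEdgesIn.InD MP dd s₀
    open PathEdgesIn MP dd
    open Outermost s₀∈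
    field
      s : ℕ
      i<s : i < s
      s<l : s < l
      s∈ : InD s

  -- Each step replaces the outermost members on a path through a member with two overlaps, decreasing their count.
  normalise : (fuel : ℕ) {K : ℕ} (D : List (Subset n)) (dd : IsDeltaDecomposition T K D) → countTwoOverlaps D < fuel →
              Σ (List (Subset n)) λ D* → Σ (IsDeltaDecomposition T K D*) λ dd* →
                All (λ M → ¬ TwoOverlaps M) D* ⊎ ThreeMembersOnPath dd*
  normalise (suc fuel) {K} D dd count< = decide (Any.any? twoOverlaps? D)
    where
    Result : Set
    Result = Σ (List (Subset n)) λ D* → Σ (IsDeltaDecomposition T K D*) λ dd* →
               All (λ M → ¬ TwoOverlaps M) D* ⊎ ThreeMembersOnPath dd*
    onPath : ∀ {M z} → M ∈ₗ D → TwoOverlaps M → z ∈ M → (MP : MaximalPath) → z ∈ OnMaximalPath.Q MP →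
             ∀ {s₀} → PathEdgesIn.InD MP dd s₀ → Result
    onPath M∈D two z∈M MP z∈Q s₀∈ = Sum.[ three , shrink ] middle?
      where
      open PathEdgesIn.Outermost MP dd s₀∈
      three : (∃ λ s → i < s × s < l × PathEdgesIn.InD MP dd s) → Result
      three (s , i<s , s<l , s∈) = D , dd , inj₂ (threeMembersOnPath MP s₀∈ s i<s s<l s∈)
      shrink : (∀ s → i < s → s < l → ¬ PathEdgesIn.InD MP dd s) → Result
      shrink none = normalise fuel D′ D′-δ-decomposition (ℕₚ.<-≤-trans (count-decreases none M∈D two z∈M z∈Q) (ℕₚ.≤-pred count<))
    fromMember : (∃ λ M → M ∈ₗ D × TwoOverlaps M) → Result
    fromMember (M , M∈D , two) =
      let (MP , z , z∈M , z∈Q) = twoOverlaps⇒maximalPath (All.lookup (proj₂ (proj₂ dd)) M∈D) two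
          (_ , s₀∈ , _) = PathEdgesIn.member-meeting-Q MP dd M∈D z∈M z∈Q
      in onPath M∈D two z∈M MP z∈Q s₀∈
    decide : Dec (Any TwoOverlaps D) → Result
    decide (yes some) = fromMember (find some)
    decide (no none) = D , dd , inj₁ (Allₚ.¬Any⇒All¬ D none)

  -- edge i, edge s, edge l and ∁ Q are four disjoint co-modules.
  threeMembersOnPath⇒4≤Δ : ∀ {K D} {dd : IsDeltaDecomposition T K D} → DeltaIs T K → ThreeMembersOnPath dd → 4 ≤ K
  threeMembersOnPath⇒4≤Δ {dd = dd} Δ≡K (threeMembersOnPath MP s₀∈ s i<s s<l s∈) =
    proj₂ Δ≡K E (disjointCoModules-unique E-coModules E-disjoint , E-coModules , E-disjoint)
    where
    open PathEdgesIn MP dd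
    open Outermost s₀∈
    edge-disjoint-∁Q : ∀ {t} → t < L → Disjoint T (edge t) (∁ Q)
    edge-disjoint-∁Q t<L z z∈ z∈∁Q = x∈p⇒x∉∁p (edge⊆Q t<L z∈) z∈∁Q
    members-disjoint : ∀ {t u} → InD t → InD u → t < u → Disjoint T (edge t) (edge u)
    members-disjoint (t< , t∈) (u< , u∈) t<u = δ-disjoint dd t∈ u∈ (λ e → ℕₚ.<-irrefl (edge-injective t< u< e) t<u)
    coModule : ∀ {t} → InD t → CoModule T (edge t)
    coModule (t< , _) = proj₁ (edge-minimal _ t<)
    E : List (Subset n)
    E = edge i ∷ edge s ∷ edge l ∷ ∁ Q ∷ []
    E-coModules : All (CoModule T) E
    E-coModules = coModule i∈ ∷ coModule s∈ ∷ coModule l∈ ∷ ∁Q-coModule ∷ []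
    E-disjoint : AllPairs (Disjoint T) E
    E-disjoint = (members-disjoint i∈ s∈ i<s ∷ members-disjoint i∈ l∈ (ℕₚ.<-trans i<s s<l) ∷ edge-disjoint-∁Q (proj₁ i∈) ∷ [])
               ∷ (members-disjoint s∈ l∈ s<l ∷ edge-disjoint-∁Q (proj₁ s∈) ∷ [])
               ∷ (edge-disjoint-∁Q (proj₁ l∈) ∷ [])
               ∷ [] ∷ []

  Δ≡3⇒δ-decomposition : DeltaIs T 3 → Σ (List (Subset n)) λ D → IsDeltaDecomposition T 3 D × All (λ M → oLeq T M 1) D
  Δ≡3⇒δ-decomposition Δ≡3 with δ-decomposition-exists Δ≡3
  ... | (D , dd) with normalise (suc (countTwoOverlaps D)) D dd (ℕₚ.n<1+n _)
  ...   | (D* , dd* , inj₁ none) = D* , dd* , All.map ¬TwoOverlaps⇒o≤1 none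
  ...   | (D* , dd* , inj₂ three) = ⊥-elim (ℕₚ.<-irrefl refl (threeMembersOnPath⇒4≤Δ Δ≡3 three))

  -- Every edge of P′ meeting Q is an edge of MP, hence inside Q; so P′ cannot cross the border of Q.
  path-outside-Q : (MP : MaximalPath) (P′ : Path) → let open PathSet P′ using () renaming (L to L′; p to p′) in
                   p′ 0 ∉ OnMaximalPath.Q MP → ∀ j → j ≤ L′ → p′ j ∉ OnMaximalPath.Q MP
  path-outside-Q MP P′ p′0∉Q zero _ = p′0∉Q
  path-outside-Q MP P′ p′0∉Q (suc j) j< p′j+1∈Q =
    let (t , t< , edge′≡) = minimalCoModule-meeting-Q (Path.edge-minimal P′ j j<) y∈pair p′j+1∈Q
    in path-outside-Q MP P′ p′0∉Q j (ℕₚ.<⇒≤ j<) (edge⊆Q t< (subst (Path.p P′ j ∈_) edge′≡ x∈pair))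
    where open OnMaximalPath MP

  path-outside-Q⁻ : (MP : MaximalPath) (P′ : Path) → let open PathSet P′ using () renaming (L to L′; p to p′) in
                    ∀ j → j ≤ L′ → p′ j ∉ OnMaximalPath.Q MP → p′ 0 ∉ OnMaximalPath.Q MP
  path-outside-Q⁻ MP P′ zero _ p′j∉Q = p′j∉Q
  path-outside-Q⁻ MP P′ (suc j) j< p′j+1∉Q = path-outside-Q⁻ MP P′ j (ℕₚ.<⇒≤ j<) p′j∉Q
    where
    open OnMaximalPath MP
    p′j∉Q : Path.p P′ j ∉ Q
    p′j∉Q p′j∈Q =
      let (t , t< , edge′≡) = minimalCoModule-meeting-Q (Path.edge-minimal P′ j j<) x∈pair p′j∈Q
      in p′j+1∉Q (edge⊆Q t< (subst (Path.p P′ (suc j) ∈_) edge′≡ y∈pair))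

  secondPath-outside-Q : (MP : MaximalPath) → ∀ {K D₁} (dd₁ : IsDeltaDecomposition T K D₁) →
    ∀ {Y} → Y ∈ₗ D₁ → (∀ z → z ∈ Y → z ∉ OnMaximalPath.Q MP) → TwoOverlaps Y →
    Σ MaximalPath λ MP′ → ∃ λ s′ → PathEdgesIn.InD MP′ dd₁ s′ × Path.p (MaximalPath.path MP′) 0 ∉ OnMaximalPath.Q MP
  secondPath-outside-Q MP dd₁ Y∈ Y-outside two =
    let (MP′ , z , z∈Y , z∈Q′) = twoOverlaps⇒maximalPath (All.lookup (proj₂ (proj₂ dd₁)) Y∈) two
        (s′ , s′∈ , Y≡edge′) = PathEdgesIn.member-meeting-Q MP′ dd₁ Y∈ z∈Y z∈Q′
    in MP′ , s′ , s′∈ , path-outside-Q⁻ MP (MaximalPath.path MP′) s′ (ℕₚ.<⇒≤ (proj₁ s′∈))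
                          (Y-outside _ (subst (Path.p (MaximalPath.path MP′) s′ ∈_) (sym Y≡edge′) x∈pair))

  -- Pushing the members on the second path to its ends keeps the three members on MP and makes
  -- the first edge of the second path, which has o ≤ 1 and lies outside Q, a member.
  quadruple-via-secondPath : (MP : MaximalPath) → let open OnMaximalPath MP in
    ∀ {K D₁} (dd₁ : IsDeltaDecomposition T K D₁) → edge 0 ∈ₗ D₁ → ∀ s → 2 ≤ s → s ≤ k → edge s ∈ₗ D₁ → edge (2 + k) ∈ₗ D₁ →
    (MP′ : MaximalPath) → ∀ {s′} → PathEdgesIn.InD MP′ dd₁ s′ → Path.p (MaximalPath.path MP′) 0 ∉ Q →
    Σ (List (Subset n)) λ D₂ → IsDeltaDecomposition T K D₂ × GoodQuadruple D₂
  quadruple-via-secondPath MP {D₁ = D₁} dd₁ first∈ s 2≤s s≤k s∈ last∈ MP′ s′∈ p′0∉Q =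
    D′ , D′-δ-decomposition ,
    quadruple-from-path MP (stays first∈ x∈pair (edge⊆Q 1≤L x∈pair)) s 2≤s s≤k (stays s∈ x∈pair (edge⊆Q s<L x∈pair))
                           (stays last∈ x∈pair (edge⊆Q ℕₚ.≤-refl x∈pair)) firstEdge∈D′ x∈pair p′0∉Q
                           (OnMaximalPath.firstEdge-¬TwoOverlaps MP′)
    where
    open OnMaximalPath MP
    module Second = PathEdgesIn MP′ dd₁
    open Second.Outermost s′∈
    s<L : s < L
    s<L = ℕₚ.≤-trans (s≤s s≤k) (ℕₚ.≤-trans (ℕₚ.n≤1+n _) (ℕₚ.n≤1+n _))
    ≢second : ∀ {X v} → v ∈ X → v ∈ Q → ∀ {t} → t < Second.L → X ≢ Second.edge t
    ≢second {X} {v} v∈X v∈Q t< X≡ =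
      let (j , j≤ , p′j≡v) = Second.Q⁻ (Second.edge⊆Q t< (subst (v ∈_) X≡ v∈X))
      in path-outside-Q MP (MaximalPath.path MP′) p′0∉Q j j≤ (subst (_∈ Q) (sym p′j≡v) v∈Q)
    stays : ∀ {X v} → X ∈ₗ D₁ → v ∈ X → v ∈ Q → X ∈ₗ D′
    stays X∈ v∈X v∈Q = kept∈D′ X∈ (≢second v∈X v∈Q (proj₁ i∈)) (≢second v∈X v∈Q (proj₁ l∈))

  threeMembers⇒goodQuadruple : ∀ {K D} {dd : IsDeltaDecomposition T K D} → DeltaIs T K → ThreeMembersOnPath dd →
                               Σ (List (Subset n)) λ D* → IsDeltaDecomposition T K D* × GoodQuadruple D*
  threeMembers⇒goodQuadruple {K} {dd = dd} Δ≡K (threeMembersOnPath MP s₀∈ s i<s s<l s∈) =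
    fromMiddle (middle⁺ s i<s s<l s∈) (PathEdgesIn.member-outside-Q MP D′-δ-decomposition Δ≡K)
    where
    open PathEdgesIn MP dd
    open Outermost s₀∈
    fromMiddle : Middle → (∃ λ Y → Y ∈ₗ D′ × (∀ z → z ∈ Y → z ∉ Q)) →
                 Σ (List (Subset n)) λ D* → IsDeltaDecomposition T K D* × GoodQuadruple D*
    fromMiddle (middle s 2≤s s≤k s∈D′ i≢l) (Y , Y∈ , Y-outside) with twoOverlaps? Y
    ... | yes two =
      let (MP′ , _ , s′∈ , p′0∉Q) = secondPath-outside-Q MP D′-δ-decomposition Y∈ Y-outside two
      in quadruple-via-secondPath MP D′-δ-decomposition firstEdge∈D′ s 2≤s s≤k s∈D′ (lastEdge∈D′ i≢l) MP′ s′∈ p′0∉Q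
    ... | no ¬two = D′ , D′-δ-decomposition ,
      quadruple-from-path MP firstEdge∈D′ s 2≤s s≤k s∈D′ (lastEdge∈D′ i≢l) Y∈ (proj₂ x∈Y) (Y-outside _ (proj₂ x∈Y)) ¬two
      where
      x∈Y : Nonempty Y
      x∈Y = coModule-nonempty (proj₁ (All.lookup (proj₂ (proj₂ D′-δ-decomposition)) Y∈))

  Δ≥4⇒goodQuadruple : ∀ K → DeltaIs T K → 4 ≤ K →
                      Σ (List (Subset n)) λ D → IsDeltaDecomposition T K D × GoodQuadruple D
  Δ≥4⇒goodQuadruple K Δ≡K 4≤K with δ-decomposition-exists Δ≡K
  ... | (D , dd) with normalise (suc (countTwoOverlaps D)) D dd (ℕₚ.n<1+n _)
  ...   | (D* , dd* , inj₁ none) = D* , dd* , fourMembers⇒goodQuadruple dd* 4≤K none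
  ...   | (D* , dd* , inj₂ three) = threeMembers⇒goodQuadruple Δ≡K three

proposition7 : {n : ℕ} (T : Tournament n) → Decomposable T →
  (DeltaIs T 2 → ∀ M → MinimalCoModule T M → oLeq T M 1)
  × (DeltaIs T 3 →
      Σ (List (Subset n)) λ D → IsDeltaDecomposition T 3 D × All (λ M → oLeq T M 1) D)
  × (∀ k → DeltaIs T k → 4 ≤ k →
      Σ (List (Subset n)) λ D → IsDeltaDecomposition T k D
        × ∃ λ M₁ → ∃ λ M₂ → ∃ λ M₃ → ∃ λ M₄ →
            (M₁ ∈ₗ D × M₂ ∈ₗ D × M₃ ∈ₗ D × M₄ ∈ₗ D)
          × (M₁ ≢ M₂ × M₁ ≢ M₃ × M₁ ≢ M₄ × M₂ ≢ M₃ × M₂ ≢ M₄ × M₃ ≢ M₄)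
          × (oLeq T M₁ 1 × oLeq T M₃ 1 × oLeq T M₄ 1)
          × ((∀ u v → u ∈ M₁ → v ∈ M₂ → Arc T u v)
             × (∀ u v → u ∈ M₂ → v ∈ M₃ → Arc T u v))
          × (∃ λ x → x ∈ M₄ ×
               ((∀ v → v ∈ M₁ → Arc T x v) ⊎ (∀ u → u ∈ M₃ → Arc T u x))))
proposition7 T _ = Δ≡2⇒o≤1 T , Δ≡3⇒δ-decomposition T , Δ≥4⇒goodQuadruple T
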